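{- Let $f:\{0,1\}^n\to\{0,1\}$ be given by $f(X)=1$ if $|X|=\lfloor n/2\rfloor+1$ and $f(X)=0$ otherwise. Then every NN representation of $f$ with $3$ anchors has resolution $\Omega(\log n)$.
   Context: $|X|$ is the number of ones in $X$; $d$ is Euclidean distance. An NN representation of $f$ is a pair of disjoint finite sets $P,N\subset\mathbb{R}^n$ (anchors) such that for every $X$ with $f(X)=1$ there is $p\in P$ with $d(X,p)<d(X,q)$ for all $q\in N$, and for every $X$ with $f(X)=0$ there is $q\in N$ with $d(X,q)<d(X,p)$ for all $p\in P$. Anchors may be assumed rational. The resolution of a rational $a/b$ ($a,b\in\mathbb{Z}$ coprime, $b\ne0$) is $RES(a/b)=\lceil\max\{\log_2|a+1|,\log_2|b+1|\}\rceil$; the resolution of an NN representation is the maximum resolution over all entries of all anchors. -}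

module Defs where

open import Data.Bool using (Bool; true; false; if_then_else_)
open import Data.Nat as ℕ using (ℕ; zero; suc; _⊔_; _/_)
open import Data.Nat.Logarithm using (⌈log₂_⌉)
open import Data.Integer as ℤ using (ℤ; ∣_∣)
open import Data.Rational as ℚ using (ℚ; _-_; _*_; _+_; _<_; 0ℚ; 1ℚ)
open import Data.Vec using (Vec; []; _∷_)
open import Data.List using (List; foldr; map)
open import Data.List.Membership.Propositional using (_∈_)
open import Data.Product using (∃-syntax; _×_)
open import Relation.Binary.PropositionalEquality using (_≡_)

ones : ∀ {n} → Vec Bool n → ℕ
ones []            = 0
ones (true  ∷ xs)  = suc (ones xs)
ones (false ∷ xs)  = ones xs

exactF : (n : ℕ) → Vec Bool n → Bool
exactF n X = ones X ℕ.≡ᵇ (n / 2 ℕ.+ 1)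

bit : Bool → ℚ
bit true  = 1ℚ
bit false = 0ℚ

dist² : ∀ {n} → Vec Bool n → Vec ℚ n → ℚ
dist² []       []       = 0ℚ
dist² (x ∷ xs) (p ∷ ps) = ((bit x - p) * (bit x - p)) + dist² xs ps

-- NN representation (P, N) of f; d(X,p) < d(X,q) ⇔ d²(X,p) < d²(X,q)
IsNNRep : ∀ {n} → (Vec Bool n → Bool) → List (Vec ℚ n) → List (Vec ℚ n) → Set
IsNNRep {n} f P N =
  ((X : Vec Bool n) → f X ≡ true →
     ∃[ p ] (p ∈ P × ((q : Vec ℚ n) → q ∈ N → dist² X p < dist² X q)))
  × ((X : Vec Bool n) → f X ≡ false →
     ∃[ q ] (q ∈ N × ((p : Vec ℚ n) → p ∈ P → dist² X q < dist² X p)))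

RES : ℚ → ℕ
RES r = ⌈log₂ ∣ ℚ.numerator r ℤ.+ ℤ.+ 1 ∣ ⌉ ⊔ ⌈log₂ ∣ ℚ.denominator r ℤ.+ ℤ.+ 1 ∣ ⌉

resVec : ∀ {n} → Vec ℚ n → ℕ
resVec []       = 0
resVec (x ∷ xs) = RES x ⊔ resVec xs

resolution : ∀ {n} → List (Vec ℚ n) → ℕ
resolution As = foldr _⊔_ 0 (map resVec As)

{-# OPTIONS --safe #-}
module Submission where

-- Inputs are subsets X of Fin n and k = ⌊n/2⌋ + 1.  For anchors p, q the difference d(X,p)² − d(X,q)²
-- is separable, Σⱼ cⱼ(Xⱼ), and adding j to X changes it by 2(qⱼ − pⱼ).  Without a positive or a negative
-- anchor some input is misclassified, and two positive anchors are ruled out by an exchange argument, so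
-- P = {p} and N = {q₁, q₂}.  The same exchange argument shows that, up to swapping q₁ and q₂, q₁ > p > q₂
-- in every coordinate.  Padding two disjoint s-sets D, D′ to exact sets gives Σ_D δ − Σ_D′ δ < 2M for
-- δ = q₁ − p and δ = p − q₂, where M bounds the entries; since distinct values of δ differ by at least
-- B⁻⁴ (B = 2^resolution), each δ is constant outside fewer than 2s = 4MB⁴ coordinates.  On all other
-- coordinates δ₂·c₁ + δ₁·c₂ is a constant below −B⁻¹², while on exact sets its total stays above a bounded
-- correction; this bounds their number, and altogether n ≤ B³³, i.e. resolution ≥ (log₂ n)/33.

open import Defs

module _ where

  open import Data.Bool using (Bool; true; false; not; _∨_; if_then_else_)
  open import Data.Bool.Properties using (not-involutive)
  open import Data.Empty using (⊥; ⊥-elim)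
  open import Data.Fin as Fin using (Fin; zero; suc)
  import Data.Fin.Properties as FinP
  open import Data.Integer as ℤ using (ℤ; +_; -[1+_]; +[1+_])
  import Data.Integer.Properties as ℤP
  open import Data.List using (List; []; _∷_; _++_; length)
  open import Data.List.Membership.Propositional using (_∈_)
  open import Data.List.Relation.Unary.Any using (here; there)
  open import Data.Nat as ℕ using (ℕ; zero; suc; z≤n; s≤s; _^_)
  open import Data.Nat.Coprimality using (1-coprimeTo)
  import Data.Nat.DivMod as ℕ
  open import Data.Nat.Induction using (<-wellFounded)
  open import Data.Nat.Logarithm using (⌊log₂_⌋; ⌈log₂_⌉; ⌊log₂⌋-mono-≤; ⌊log₂[2^n]⌋≡n)
  open import Data.Nat.Logarithm.Core using (⌈log2⌉)
  import Data.Nat.Properties as ℕP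
  open import Data.Product using (Σ-syntax; ∃-syntax; _×_; _,_; proj₁; proj₂)
  open import Data.Rational as ℚ
    using (ℚ; mkℚ; _+_; _*_; _-_; -_; 0ℚ; 1ℚ; _<_; _≤_; ∣_∣; ↥_; ↧ₙ_)
  open import Data.Rational.Literals using (fromℤ)
  import Data.Rational.Properties as ℚP
  import Data.Rational.Unnormalised as ℚᵘ
  import Data.Rational.Unnormalised.Properties as ℚᵘP
  open import Data.Rational.Solver using (module +-*-Solver)
  open import Data.Sum using (_⊎_; inj₁; inj₂)
  open import Data.Vec using (Vec; []; _∷_; lookup; tabulate)
  open import Data.Vec.Functional using (updateAt; tail) renaming (_∷_ to _◂_)
  open import Data.Vec.Functional.Properties using (updateAt-minimal)
  open import Function using (const; _∘_; id)
  open import Induction.WellFounded using (Acc; acc)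
  open import Relation.Nullary using (¬_; Dec; yes; no; does)
  open import Relation.Nullary.Decidable using (dec-true; dec-false)
  open import Relation.Binary.PropositionalEquality
  open +-*-Solver using (solve; _:=_; _:+_; _:-_; _:*_; :-_; con)

  fromℕ : ℕ → ℚ
  fromℕ n = fromℤ (+ n)

  fromℕ-+ : ∀ m n → fromℕ (m ℕ.+ n) ≡ fromℕ m + fromℕ n
  fromℕ-+ m n = ℚP.toℚᵘ-injective (ℚᵘP.≃-sym (ℚᵘP.≃-trans (ℚP.toℚᵘ-homo-+ (fromℕ m) (fromℕ n)) (ℚᵘ.*≡* eq)))
    where
    eq : ((+ m) ℤ.* (+ 1) ℤ.+ (+ n) ℤ.* (+ 1)) ℤ.* (+ 1) ≡ (+ (m ℕ.+ n)) ℤ.* (+ 1)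
    eq rewrite ℤP.*-identityʳ (+ m) | ℤP.*-identityʳ (+ n) | ℤP.*-identityʳ (+ m ℤ.+ + n) = sym (ℤP.pos-+ m n)

  fromℕ-* : ∀ m n → fromℕ (m ℕ.* n) ≡ fromℕ m * fromℕ n
  fromℕ-* m n = ℚP.toℚᵘ-injective (ℚᵘP.≃-sym (ℚᵘP.≃-trans (ℚP.toℚᵘ-homo-* (fromℕ m) (fromℕ n)) (ℚᵘ.*≡* eq)))
    where
    eq : ((+ m) ℤ.* (+ n)) ℤ.* (+ 1) ≡ (+ (m ℕ.* n)) ℤ.* (+ 1)
    eq rewrite ℤP.*-identityʳ (+ m ℤ.* + n) | ℤP.*-identityʳ (+ (m ℕ.* n)) = sym (ℤP.pos-* m n)

  fromℕ-mono-≤ : ∀ {m n} → m ℕ.≤ n → fromℕ m ≤ fromℕ n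
  fromℕ-mono-≤ {m} {n} m≤n = ℚ.*≤* (ℤP.*-monoʳ-≤-nonNeg (+ 1) (ℤ.+≤+ m≤n))

  fromℕ-mono-< : ∀ {m n} → m ℕ.< n → fromℕ m < fromℕ n
  fromℕ-mono-< {m} {n} m<n =
    ℚ.*<* (subst₂ ℤ._<_ (sym (ℤP.*-identityʳ (+ m))) (sym (ℤP.*-identityʳ (+ n))) (ℤ.+<+ m<n))

  fromℕ-cancel-< : ∀ {m n} → fromℕ m < fromℕ n → m ℕ.< n
  fromℕ-cancel-< {m} {n} (ℚ.*<* m<n)
    with subst₂ ℤ._<_ (ℤP.*-identityʳ (+ m)) (ℤP.*-identityʳ (+ n)) m<n
  ... | ℤ.+<+ m<n = m<n

  0≤fromℕ : ∀ n → 0ℚ ≤ fromℕ n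
  0≤fromℕ n = fromℕ-mono-≤ z≤n

  ≤⇒≯ : ∀ {p q} → p ≤ q → ¬ (q < p)
  ≤⇒≯ p≤q q<p = ℚP.<-irrefl refl (ℚP.<-≤-trans q<p p≤q)

  p<q⇒0<q-p : ∀ {p q} → p < q → 0ℚ < q - p
  p<q⇒0<q-p {p} h = subst₂ _<_ (ℚP.+-inverseʳ p) refl (ℚP.+-monoˡ-< (- p) h)

  p≤q⇒0≤q-p : ∀ {p q} → p ≤ q → 0ℚ ≤ q - p
  p≤q⇒0≤q-p {p} h = subst₂ _≤_ (ℚP.+-inverseʳ p) refl (ℚP.+-monoˡ-≤ (- p) h)

  0<q-p⇒p<q : ∀ {p q} → 0ℚ < q - p → p < q
  0<q-p⇒p<q {p} {q} h =
    subst₂ _<_ (ℚP.+-identityʳ p) (solve 2 (λ p q → p :+ (q :- p) := q) refl p q) (ℚP.+-monoʳ-< p h)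

  0≤q-p⇒p≤q : ∀ {p q} → 0ℚ ≤ q - p → p ≤ q
  0≤q-p⇒p≤q {p} {q} h =
    subst₂ _≤_ (ℚP.+-identityʳ p) (solve 2 (λ p q → p :+ (q :- p) := q) refl p q) (ℚP.+-monoʳ-≤ p h)

  neg<0⇒0<- : ∀ {p} → p < 0ℚ → 0ℚ < - p
  neg<0⇒0<- {p} h = subst (0ℚ <_) (ℚP.+-identityˡ (- p)) (p<q⇒0<q-p h)

  p<0∧q<0⇒p+q<0 : ∀ {p q} → p < 0ℚ → q < 0ℚ → p + q < 0ℚ
  p<0∧q<0⇒p+q<0 h₁ h₂ = subst₂ _<_ refl (ℚP.+-identityʳ 0ℚ) (ℚP.+-mono-< h₁ h₂)

  0<p+q∧p<0⇒0<q : ∀ {p q} → 0ℚ < p + q → p < 0ℚ → 0ℚ < q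
  0<p+q∧p<0⇒0<q {p} {q} 0<p+q p<0 =
    subst (0ℚ <_) (solve 2 (λ p q → (p :+ q) :+ (:- p) := q) refl p q) (ℚP.+-mono-< 0<p+q (neg<0⇒0<- p<0))

  0<p-q∧p<0⇒q<0 : ∀ {p q} → 0ℚ < p - q → p < 0ℚ → q < 0ℚ
  0<p-q∧p<0⇒q<0 {p} {q} 0<p-q p<0 = 0<q-p⇒p<q
    (subst (0ℚ <_) (solve 2 (λ p q → (p :- q) :+ (:- p) := con 0ℚ :- q) refl p q) (ℚP.+-mono-< 0<p-q (neg<0⇒0<- p<0)))

  p<0∧0<q⇒p-q<0 : ∀ {p q} → p < 0ℚ → 0ℚ < q → p - q < 0ℚ
  p<0∧0<q⇒p-q<0 {p} {q} p<0 0<q = 0<q-p⇒p<q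
    (subst (0ℚ <_) (solve 2 (λ p q → (:- p) :+ q := con 0ℚ :- (p :- q)) refl p q) (ℚP.+-mono-< (neg<0⇒0<- p<0) 0<q))

  *-pos : ∀ {p q} → 0ℚ < p → 0ℚ < q → 0ℚ < p * q
  *-pos {p} {q} h₁ h₂ = ℚP.positive⁻¹ _ {{ℚP.pos*pos⇒pos p {{ℚ.positive h₁}} q {{ℚ.positive h₂}}}}

  *-nonNeg : ∀ {p q} → 0ℚ ≤ p → 0ℚ ≤ q → 0ℚ ≤ p * q
  *-nonNeg {p} {q} h₁ h₂ =
    ℚP.nonNegative⁻¹ _ {{ℚP.nonNeg*nonNeg⇒nonNeg p {{ℚ.nonNegative h₁}} q {{ℚ.nonNegative h₂}}}}

  *-mono-≤ : ∀ {a A x X} → 0ℚ ≤ a → a ≤ A → x ≤ X → 0ℚ ≤ X → a * x ≤ A * X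
  *-mono-≤ {a} {A} {x} {X} 0≤a a≤A x≤X 0≤X = ℚP.≤-trans
    (ℚP.*-monoˡ-≤-nonNeg a {{ℚ.nonNegative 0≤a}} x≤X) (ℚP.*-monoʳ-≤-nonNeg X {{ℚ.nonNegative 0≤X}} a≤A)

  ≤fromℕ-+ : ∀ {x y} m n → x ≤ fromℕ m → y ≤ fromℕ n → x + y ≤ fromℕ (m ℕ.+ n)
  ≤fromℕ-+ m n x≤m y≤n = subst (_ ≤_) (sym (fromℕ-+ m n)) (ℚP.+-mono-≤ x≤m y≤n)

  ≤fromℕ-* : ∀ {x y} m n → 0ℚ ≤ x → x ≤ fromℕ m → y ≤ fromℕ n → x * y ≤ fromℕ (m ℕ.* n)
  ≤fromℕ-* m n 0≤x x≤m y≤n = subst (_ ≤_) (sym (fromℕ-* m n)) (*-mono-≤ 0≤x x≤m y≤n (0≤fromℕ n))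

  p≤∣p∣ : ∀ p → p ≤ ∣ p ∣
  p≤∣p∣ p with ℚP.∣p∣≡p∨∣p∣≡-p p
  ... | inj₁ e = ℚP.≤-reflexive (sym e)
  ... | inj₂ e = ℚP.≤-trans p≤0 (ℚP.0≤∣p∣ p)
    where
    p≤0 : p ≤ 0ℚ
    p≤0 = 0≤q-p⇒p≤q (subst (0ℚ ≤_) (trans e (sym (ℚP.+-identityˡ (- p)))) (ℚP.0≤∣p∣ p))

  0≤p*p : ∀ p → 0ℚ ≤ p * p
  0≤p*p p with ℚP.≤-total 0ℚ p
  ... | inj₁ 0≤p = *-nonNeg 0≤p 0≤p
  ... | inj₂ p≤0 = subst (0ℚ ≤_) (solve 1 (λ p → (:- p) :* (:- p) := p :* p) refl p) (*-nonNeg 0≤-p 0≤-p)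
    where
    0≤-p : 0ℚ ≤ - p
    0≤-p = subst (0ℚ ≤_) (ℚP.+-identityˡ (- p)) (p≤q⇒0≤q-p p≤0)

  ∣p∣≤q⇒p*p≤q*q : ∀ {p q} → ∣ p ∣ ≤ q → p * p ≤ q * q
  ∣p∣≤q⇒p*p≤q*q {p} {q} h = subst (_≤ q * q) ∣p∣*∣p∣≡p*p (*-mono-≤ (ℚP.0≤∣p∣ p) h h 0≤q)
    where
    0≤q : 0ℚ ≤ q
    0≤q = ℚP.≤-trans (ℚP.0≤∣p∣ p) h
    ∣p∣*∣p∣≡p*p : ∣ p ∣ * ∣ p ∣ ≡ p * p
    ∣p∣*∣p∣≡p*p = trans (sym (ℚP.∣p*q∣≡∣p∣*∣q∣ p p)) (ℚP.0≤p⇒∣p∣≡p (0≤p*p p))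

  ∣p-q∣≤ : ∀ {p q P Q} → ∣ p ∣ ≤ P → ∣ q ∣ ≤ Q → ∣ p - q ∣ ≤ P + Q
  ∣p-q∣≤ {p} {q} hp hq = ℚP.≤-trans (ℚP.∣p-q∣≤∣p∣+∣q∣ p q) (ℚP.+-mono-≤ hp hq)

  ∣bit∣≤1 : ∀ b → ∣ bit b ∣ ≤ 1ℚ
  ∣bit∣≤1 true  = ℚP.≤-refl
  ∣bit∣≤1 false = ℚ.*≤* (ℤ.+≤+ z≤n)

  two : ℚ
  two = 1ℚ + 1ℚ

  0<two : 0ℚ < two
  0<two = ℚ.*<* (ℤ.+<+ (s≤s z≤n))

  two*-cancel-< : ∀ {p q} → two * p < two * q → p < q
  two*-cancel-< = ℚP.*-cancelˡ-<-nonNeg two {{ℚ.nonNegative (ℚP.<⇒≤ 0<two)}}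

  -- Subsets of Fin n as Boolean functions

  true≢false : ¬ (true ≡ false)
  true≢false ()

  not-true : ∀ {b} → not b ≡ true → b ≡ false
  not-true {false} _ = refl

  not-false : ∀ {b} → not b ≡ false → b ≡ true
  not-false {true} _ = refl

  ∨-true-l : ∀ {a b} → a ≡ true → a ∨ b ≡ true
  ∨-true-l refl = refl

  ∨-true-r : ∀ a {b} → b ≡ true → a ∨ b ≡ true
  ∨-true-r false e = e
  ∨-true-r true  _ = refl

  ∨-false-l : ∀ a {b} → a ∨ b ≡ false → a ≡ false
  ∨-false-l false _ = refl

  ∨-false-r : ∀ a {b} → a ∨ b ≡ false → b ≡ false
  ∨-false-r false e = e

  does-true : ∀ {p} {P : Set p} (P? : Dec P) → does P? ≡ true → P
  does-true (yes p) _ = p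

  does-false : ∀ {p} {P : Set p} (P? : Dec P) → does P? ≡ false → ¬ P
  does-false (no ¬p) _ = ¬p

  bitₙ : Bool → ℕ
  bitₙ true  = 1
  bitₙ false = 0

  count : ∀ {n} → (Fin n → Bool) → ℕ
  count {zero}  X = 0
  count {suc n} X = bitₙ (X zero) ℕ.+ count (tail X)

  ∑ : ∀ {n} → (Fin n → ℚ) → ℚ
  ∑ {zero}  h = 0ℚ
  ∑ {suc n} h = h zero + ∑ (tail h)

  ∅ : ∀ {n} → Fin n → Bool
  ∅ _ = false

  _⊆_ : ∀ {n} → (Fin n → Bool) → (Fin n → Bool) → Set
  X ⊆ Y = ∀ j → X j ≡ true → Y j ≡ true

  Disjoint : ∀ {n} → (Fin n → Bool) → (Fin n → Bool) → Set
  Disjoint X Y = ∀ j → X j ≡ true → Y j ≡ false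

  Disjoint-sym : ∀ {n} {X Y : Fin n → Bool} → Disjoint X Y → Disjoint Y X
  Disjoint-sym {X = X} disj j Yj with X j in Xj
  ... | false = refl
  ... | true  = ⊥-elim (true≢false (trans (sym Yj) (disj j Xj)))

  _∪_ : ∀ {n} → (Fin n → Bool) → (Fin n → Bool) → Fin n → Bool
  (X ∪ Y) j = X j ∨ Y j

  ∁ : ∀ {n} → (Fin n → Bool) → Fin n → Bool
  ∁ X j = not (X j)

  ⁅_⁆ : ∀ {n} → Fin n → Fin n → Bool
  ⁅ i ⁆ j = does (j Fin.≟ i)

  ∈⁅i⁆ : ∀ {n} (i : Fin n) → ⁅ i ⁆ i ≡ true
  ∈⁅i⁆ i = dec-true (i Fin.≟ i) refl

  ∈⁅i⁆⇒≡ : ∀ {n} {i j : Fin n} → ⁅ i ⁆ j ≡ true → j ≡ i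
  ∈⁅i⁆⇒≡ {i = i} {j} = does-true (j Fin.≟ i)

  ⁅i⁆-disjoint : ∀ {n} {i j : Fin n} → ¬ (i ≡ j) → Disjoint ⁅ i ⁆ ⁅ j ⁆
  ⁅i⁆-disjoint {j = j} i≢j x x∈⁅i⁆ = dec-false (x Fin.≟ j) (i≢j ∘ trans (sym (∈⁅i⁆⇒≡ x∈⁅i⁆)))

  _[_]≔_ : ∀ {n} → (Fin n → Bool) → Fin n → Bool → Fin n → Bool
  X [ j ]≔ b = updateAt X j (const b)

  count-cong : ∀ {n} {X Y : Fin n → Bool} → (∀ j → X j ≡ Y j) → count X ≡ count Y
  count-cong {zero}  e = refl
  count-cong {suc n} e = cong₂ ℕ._+_ (cong bitₙ (e zero)) (count-cong (e ∘ suc))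

  count-∅ : ∀ {n} → count (∅ {n}) ≡ 0
  count-∅ {zero}  = refl
  count-∅ {suc n} = count-∅ {n}

  count-⁅i⁆ : ∀ {n} (i : Fin n) → count ⁅ i ⁆ ≡ 1
  count-⁅i⁆ {suc n} zero    = cong suc (count-∅ {n})
  count-⁅i⁆ {suc n} (suc i) = trans (count-cong ⁅i⁆-suc) (count-⁅i⁆ i)
    where
    ⁅i⁆-suc : ∀ j → does (suc j Fin.≟ suc i) ≡ does (j Fin.≟ i)
    ⁅i⁆-suc j with j Fin.≟ i
    ... | yes _ = refl
    ... | no  _ = refl

  count+count∁ : ∀ {n} (X : Fin n → Bool) → count X ℕ.+ count (∁ X) ≡ n
  count+count∁ {zero}  X = refl
  count+count∁ {suc n} X with X zero
  ... | true  = cong suc (count+count∁ (tail X))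
  ... | false = trans (ℕP.+-suc (count (tail X)) _) (cong suc (count+count∁ (tail X)))

  count≤n : ∀ {n} (X : Fin n → Bool) → count X ℕ.≤ n
  count≤n X = subst (count X ℕ.≤_) (count+count∁ X) (ℕP.m≤m+n _ _)

  count-mono : ∀ {n} {X Y : Fin n → Bool} → X ⊆ Y → count X ℕ.≤ count Y
  count-mono {zero}  X⊆Y = z≤n
  count-mono {suc n} {X} {Y} X⊆Y with X zero in X₀ | Y zero in Y₀
  ... | true  | true  = s≤s (count-mono (X⊆Y ∘ suc))
  ... | true  | false = ⊥-elim (true≢false (trans (sym (X⊆Y zero X₀)) Y₀))
  ... | false | true  = ℕP.m≤n⇒m≤1+n (count-mono (X⊆Y ∘ suc))
  ... | false | false = count-mono (X⊆Y ∘ suc)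

  count-∪-≤ : ∀ {n} (X Y : Fin n → Bool) → count (X ∪ Y) ℕ.≤ count X ℕ.+ count Y
  count-∪-≤ {zero}  X Y = z≤n
  count-∪-≤ {suc n} X Y with X zero | Y zero
  ... | true  | true  = s≤s (ℕP.≤-trans (count-∪-≤ (tail X) (tail Y)) (ℕP.+-monoʳ-≤ (count (tail X)) (ℕP.n≤1+n _)))
  ... | true  | false = s≤s (count-∪-≤ (tail X) (tail Y))
  ... | false | true  = subst (suc (count (tail X ∪ tail Y)) ℕ.≤_) (sym (ℕP.+-suc _ _)) (s≤s (count-∪-≤ (tail X) (tail Y)))
  ... | false | false = count-∪-≤ (tail X) (tail Y)

  count-∪-disjoint : ∀ {n} (X Y : Fin n → Bool) → Disjoint X Y → count (X ∪ Y) ≡ count X ℕ.+ count Y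
  count-∪-disjoint {zero}  X Y disj = refl
  count-∪-disjoint {suc n} X Y disj with X zero in X₀ | Y zero in Y₀
  ... | true  | true  = ⊥-elim (true≢false (trans (sym Y₀) (disj zero X₀)))
  ... | true  | false = cong suc (count-∪-disjoint (tail X) (tail Y) (disj ∘ suc))
  ... | false | true  = trans (cong suc (count-∪-disjoint (tail X) (tail Y) (disj ∘ suc))) (sym (ℕP.+-suc _ _))
  ... | false | false = count-∪-disjoint (tail X) (tail Y) (disj ∘ suc)

  count-disjoint-≤ : ∀ {n} {X Y : Fin n → Bool} → Disjoint X Y → count X ℕ.+ count Y ℕ.≤ n
  count-disjoint-≤ {X = X} {Y} disj = subst (ℕ._≤ _) (count-∪-disjoint X Y disj) (count≤n (X ∪ Y))

  count<n⇒∃false : ∀ {n} (X : Fin n → Bool) → count X ℕ.< n → ∃[ j ] X j ≡ false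
  count<n⇒∃false {suc n} X X<n with X zero in X₀
  ... | false = zero , X₀
  ... | true with count<n⇒∃false (tail X) (ℕP.≤-pred X<n)
  ...   | j , Xj = suc j , Xj

  0<count⇒∃true : ∀ {n} (X : Fin n → Bool) → 0 ℕ.< count X → ∃[ j ] X j ≡ true
  0<count⇒∃true {suc n} X 0<X with X zero in X₀
  ... | true  = zero , X₀
  ... | false with 0<count⇒∃true (tail X) 0<X
  ...   | j , Xj = suc j , Xj

  count-[]≔true : ∀ {n} (X : Fin n → Bool) j → X j ≡ false → count (X [ j ]≔ true) ≡ suc (count X)
  count-[]≔true X zero    Xj rewrite Xj = refl
  count-[]≔true X (suc j) Xj =
    trans (cong (bitₙ (X zero) ℕ.+_) (count-[]≔true (tail X) j Xj)) (ℕP.+-suc _ _)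

  count-[]≔false : ∀ {n} (X : Fin n → Bool) j → X j ≡ true → suc (count (X [ j ]≔ false)) ≡ count X
  count-[]≔false X zero    Xj rewrite Xj = refl
  count-[]≔false X (suc j) Xj =
    trans (sym (ℕP.+-suc _ _)) (cong (bitₙ (X zero) ℕ.+_) (count-[]≔false (tail X) j Xj))

  Extension : ∀ {n} (T F : Fin n → Bool) (k : ℕ) → Set
  Extension {n} T F k = Σ[ X ∈ (Fin n → Bool) ] (count X ≡ k × T ⊆ X × Disjoint F X)

  extension-∷ : ∀ {n} {T F : Fin (suc n) → Bool} {k} (b : Bool) →
    (T zero ≡ true → b ≡ true) → (F zero ≡ true → b ≡ false) →
    Extension (tail T) (tail F) k → Extension T F (bitₙ b ℕ.+ k)
  extension-∷ b T₀⇒b F₀⇒¬b (X , count≡k , T⊆X , F∩X=∅) =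
    (b ◂ X) , cong (bitₙ b ℕ.+_) count≡k ,
    (λ { zero → T₀⇒b ; (suc j) → T⊆X j }) , (λ { zero → F₀⇒¬b ; (suc j) → F∩X=∅ j })

  extend : ∀ {n} (T F : Fin n → Bool) k → Disjoint T F → count T ℕ.≤ k → k ℕ.+ count F ℕ.≤ n →
    Extension T F k
  extend {zero}  T F k _ _ k≤0 =
    (λ ()) , sym (ℕP.n≤0⇒n≡0 (ℕP.≤-trans (ℕP.m≤m+n k 0) k≤0)) , (λ ()) , (λ ())
  extend {suc n} T F k disj T≤k k+F≤n with T zero in T₀ | F zero in F₀
  ... | true  | true  = ⊥-elim (true≢false (trans (sym F₀) (disj zero T₀)))
  extend {suc n} T F (suc k) disj T≤k k+F≤n | true | false =
    extension-∷ true (λ _ → refl) (λ F₀′ → ⊥-elim (true≢false (trans (sym F₀′) F₀)))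
      (extend (tail T) (tail F) k (disj ∘ suc) (ℕP.≤-pred T≤k) (ℕP.≤-pred k+F≤n))
  ... | false | true  =
    extension-∷ false (λ T₀′ → ⊥-elim (true≢false (trans (sym T₀′) T₀))) (λ _ → refl)
      (extend (tail T) (tail F) k (disj ∘ suc) T≤k (ℕP.≤-pred (subst (ℕ._≤ suc n) (ℕP.+-suc k _) k+F≤n)))
  ... | false | false with k ℕ.+ count (tail F) ℕ.≤? n
  ...   | yes k+F≤n′ =
    extension-∷ false (λ T₀′ → ⊥-elim (true≢false (trans (sym T₀′) T₀))) (λ _ → refl)
      (extend (tail T) (tail F) k (disj ∘ suc) T≤k k+F≤n′)
  ...   | no  k+F≰n′ = take k T≤k k+F≤n k+F≰n′
    where
    take : ∀ k → count (tail T) ℕ.≤ k → k ℕ.+ count (tail F) ℕ.≤ suc n → ¬ (k ℕ.+ count (tail F) ℕ.≤ n) →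
      Extension T F k
    take zero    _   _     k+F≰n′ = ⊥-elim (k+F≰n′ (count≤n (tail F)))
    take (suc k) T≤k k+F≤n k+F≰n′ =
      extension-∷ true (λ _ → refl) (λ F₀′ → ⊥-elim (true≢false (trans (sym F₀′) F₀)))
        (extend (tail T) (tail F) k (disj ∘ suc) T≤k′ (ℕP.≤-pred k+F≤n))
      where
      k+F≡n : k ℕ.+ count (tail F) ≡ n
      k+F≡n = ℕP.suc-injective (ℕP.≤-antisym k+F≤n (ℕP.≰⇒> k+F≰n′))
      T≤k′ : count (tail T) ℕ.≤ k
      T≤k′ = ℕP.+-cancelʳ-≤ (count (tail F)) _ _
        (subst (count (tail T) ℕ.+ count (tail F) ℕ.≤_) (sym k+F≡n) (count-disjoint-≤ (disj ∘ suc)))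

  sized : ∀ {n k} → k ℕ.≤ n → Σ[ X ∈ (Fin n → Bool) ] count X ≡ k
  sized {n} {k} k≤n with extend ∅ ∅ k (λ _ ()) (subst (ℕ._≤ k) (sym (count-∅ {n})) z≤n)
                           (subst (λ m → k ℕ.+ m ℕ.≤ n) (sym (count-∅ {n})) (subst (ℕ._≤ n) (sym (ℕP.+-identityʳ k)) k≤n))
  ... | X , count≡k , _ = X , count≡k

  sized-∌ : ∀ {n k} → k ℕ.< n → ∀ j → Σ[ X ∈ (Fin n → Bool) ] (count X ≡ k × X j ≡ false)
  sized-∌ {n} {k} k<n j with extend ∅ ⁅ j ⁆ k (λ _ ()) (subst (ℕ._≤ k) (sym (count-∅ {n})) z≤n)
                              (subst (λ m → k ℕ.+ m ℕ.≤ n) (sym (count-⁅i⁆ j)) (subst (ℕ._≤ n) (ℕP.+-comm 1 k) k<n))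
  ... | X , count≡k , _ , j∉X = X , count≡k , j∉X j (∈⁅i⁆ j)

  sized-∋∌ : ∀ {n k} → 1 ℕ.≤ k → k ℕ.< n → ∀ {i j} → ¬ (i ≡ j) →
    Σ[ X ∈ (Fin n → Bool) ] (count X ≡ k × X i ≡ true × X j ≡ false)
  sized-∋∌ {n} {k} 1≤k k<n {i} {j} i≢j
    with extend ⁅ i ⁆ ⁅ j ⁆ k (⁅i⁆-disjoint i≢j) (subst (ℕ._≤ k) (sym (count-⁅i⁆ i)) 1≤k)
           (subst (λ m → k ℕ.+ m ℕ.≤ n) (sym (count-⁅i⁆ j)) (subst (ℕ._≤ n) (ℕP.+-comm 1 k) k<n))
  ... | X , count≡k , i∈X , j∉X = X , count≡k , i∈X i (∈⁅i⁆ i) , j∉X j (∈⁅i⁆ j)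

  sized-∋ : ∀ {n k} → 1 ℕ.≤ k → k ℕ.≤ n → ∀ j → Σ[ X ∈ (Fin n → Bool) ] (count X ≡ k × X j ≡ true)
  sized-∋ {n} {k} 1≤k k≤n j
    with extend ⁅ j ⁆ ∅ k (λ _ _ → refl) (subst (ℕ._≤ k) (sym (count-⁅i⁆ j)) 1≤k)
           (subst (λ m → k ℕ.+ m ℕ.≤ n) (sym (count-∅ {n})) (subst (ℕ._≤ n) (sym (ℕP.+-identityʳ k)) k≤n))
  ... | X , count≡k , j∈X , _ = X , count≡k , j∈X j (∈⁅i⁆ j)

  sized-⊆ : ∀ {n s} (P : Fin n → Bool) → s ℕ.≤ count P → Σ[ D ∈ (Fin n → Bool) ] (count D ≡ s × D ⊆ P)
  sized-⊆ {n} {s} P s≤P with extend ∅ (∁ P) s (λ _ ()) (subst (ℕ._≤ s) (sym (count-∅ {n})) z≤n)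
                            (subst (s ℕ.+ count (∁ P) ℕ.≤_) (count+count∁ P) (ℕP.+-monoˡ-≤ (count (∁ P)) s≤P))
  ... | D , count≡s , _ , ∁P∩D=∅ = D , count≡s , D⊆P
    where
    D⊆P : D ⊆ P
    D⊆P j Dj with P j in Pj
    ... | true  = refl
    ... | false = ⊥-elim (true≢false (trans (sym Dj) (∁P∩D=∅ j (cong not Pj))))

  count-[]≔true-≢ : ∀ {n k} (X : Fin n → Bool) j → count X ≡ k → X j ≡ false → ¬ (count (X [ j ]≔ true) ≡ k)
  count-[]≔true-≢ X j count≡k Xj e =
    ℕP.1+n≢n (trans (sym (trans (count-[]≔true X j Xj) (cong suc count≡k))) e)

  count-[]≔false-≢ : ∀ {n k} (X : Fin n → Bool) j → count X ≡ k → X j ≡ true → ¬ (count (X [ j ]≔ false) ≡ k)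
  count-[]≔false-≢ X j count≡k Xj e =
    ℕP.1+n≢n (trans (sym (cong suc e)) (trans (count-[]≔false X j Xj) count≡k))

  module _ {a ℓ} {A : Set a} {_≼_ : A → A → Set ℓ}
    (≼-refl : ∀ {x} → x ≼ x) (≼-trans : ∀ {x y z} → x ≼ y → y ≼ z → x ≼ z)
    (≼-total : ∀ x y → x ≼ y ⊎ y ≼ x) where

    minimum : ∀ {n} (X : Fin n → Bool) (h : Fin n → A) →
      (∀ j → X j ≡ false) ⊎ ∃[ m ] (X m ≡ true × ∀ j → X j ≡ true → h m ≼ h j)
    minimum {zero}  X h = inj₁ (λ ())
    minimum {suc n} X h with minimum (tail X) (h ∘ suc) | X zero in X₀
    ... | inj₁ empty | false = inj₁ λ { zero → X₀ ; (suc j) → empty j }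
    ... | inj₁ empty | true  =
      inj₂ (zero , X₀ , λ { zero _ → ≼-refl ; (suc j) Xj → ⊥-elim (true≢false (trans (sym Xj) (empty j))) })
    ... | inj₂ (m , Xm , min) | false =
      inj₂ (suc m , Xm , λ { zero X₀′ → ⊥-elim (true≢false (trans (sym X₀′) X₀)) ; (suc j) → min j })
    ... | inj₂ (m , Xm , min) | true with ≼-total (h zero) (h (suc m))
    ...   | inj₁ h₀≼hm = inj₂ (zero , X₀ , λ { zero _ → ≼-refl ; (suc j) Xj → ≼-trans h₀≼hm (min j Xj) })
    ...   | inj₂ hm≼h₀ = inj₂ (suc m , Xm , λ { zero _ → hm≼h₀ ; (suc j) → min j })

  ∑-cong : ∀ {n} {f g : Fin n → ℚ} → (∀ j → f j ≡ g j) → ∑ f ≡ ∑ g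
  ∑-cong {zero}  e = refl
  ∑-cong {suc n} e = cong₂ _+_ (e zero) (∑-cong (e ∘ suc))

  ∑-+ : ∀ {n} (f g : Fin n → ℚ) → ∑ (λ j → f j + g j) ≡ ∑ f + ∑ g
  ∑-+ {zero}  f g = refl
  ∑-+ {suc n} f g rewrite ∑-+ (tail f) (tail g) =
    solve 4 (λ a b c d → (a :+ b) :+ (c :+ d) := (a :+ c) :+ (b :+ d)) refl (f zero) (g zero) (∑ (tail f)) (∑ (tail g))

  ∑-* : ∀ {n} (a : ℚ) (f : Fin n → ℚ) → ∑ (λ j → a * f j) ≡ a * ∑ f
  ∑-* {zero}  a f = sym (ℚP.*-zeroʳ a)
  ∑-* {suc n} a f rewrite ∑-* a (tail f) = sym (ℚP.*-distribˡ-+ a (f zero) _)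

  ∑-neg : ∀ {n} (f : Fin n → ℚ) → ∑ (λ j → - f j) ≡ - ∑ f
  ∑-neg {zero}  f = refl
  ∑-neg {suc n} f rewrite ∑-neg (tail f) = sym (ℚP.neg-distrib-+ (f zero) _)

  ∑-- : ∀ {n} (f g : Fin n → ℚ) → ∑ (λ j → f j - g j) ≡ ∑ f - ∑ g
  ∑-- f g = trans (∑-+ f (λ j → - g j)) (cong (_+_ (∑ f)) (∑-neg g))

  ∑-mono-≤ : ∀ {n} {f g : Fin n → ℚ} → (∀ j → f j ≤ g j) → ∑ f ≤ ∑ g
  ∑-mono-≤ {zero}  f≤g = ℚP.≤-refl
  ∑-mono-≤ {suc n} f≤g = ℚP.+-mono-≤ (f≤g zero) (∑-mono-≤ (f≤g ∘ suc))

  ∑-if : ∀ {n} (X : Fin n → Bool) (a b : ℚ) →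
    ∑ (λ j → if X j then a else b) ≡ fromℕ (count X) * a + fromℕ (count (∁ X)) * b
  ∑-if {zero}  X a b = solve 2 (λ a b → con 0ℚ := con 0ℚ :* a :+ con 0ℚ :* b) refl a b
  ∑-if {suc n} X a b with X zero
  ... | true  rewrite ∑-if (tail X) a b | fromℕ-+ 1 (count (tail X)) =
    solve 4 (λ a b x y → a :+ (x :* a :+ y :* b) := (con 1ℚ :+ x) :* a :+ y :* b) refl
      a b (fromℕ (count (tail X))) (fromℕ (count (∁ (tail X))))
  ... | false rewrite ∑-if (tail X) a b | fromℕ-+ 1 (count (∁ (tail X))) =
    solve 4 (λ a b x y → b :+ (x :* a :+ y :* b) := x :* a :+ (con 1ℚ :+ y) :* b) refl
      a b (fromℕ (count (tail X))) (fromℕ (count (∁ (tail X))))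

  sumOn : ∀ {n} → (Fin n → Bool) → (Fin n → ℚ) → ℚ
  sumOn D h = ∑ (λ j → if D j then h j else 0ℚ)

  sumOn-cong : ∀ {n} (D : Fin n → Bool) {g h : Fin n → ℚ} → (∀ j → g j ≡ h j) → sumOn D g ≡ sumOn D h
  sumOn-cong D e = ∑-cong (λ j → cong (if D j then_else 0ℚ) (e j))

  sumOn-* : ∀ {n} (D : Fin n → Bool) (a : ℚ) (h : Fin n → ℚ) → sumOn D (λ j → a * h j) ≡ a * sumOn D h
  sumOn-* D a h = trans (∑-cong factor) (∑-* a (λ j → if D j then h j else 0ℚ))
    where
    factor : ∀ j → (if D j then a * h j else 0ℚ) ≡ a * (if D j then h j else 0ℚ)
    factor j with D j
    ... | true  = refl
    ... | false = sym (ℚP.*-zeroʳ a)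

  sumOn-const : ∀ {n} (D : Fin n → Bool) (a : ℚ) → sumOn D (const a) ≡ fromℕ (count D) * a
  sumOn-const D a = trans (∑-if D a 0ℚ)
    (solve 3 (λ x y a → x :* a :+ y :* con 0ℚ := x :* a) refl (fromℕ (count D)) (fromℕ (count (∁ D))) a)

  sumOn-mono-≤ : ∀ {n} (D : Fin n → Bool) {g h : Fin n → ℚ} → (∀ j → D j ≡ true → g j ≤ h j) →
    sumOn D g ≤ sumOn D h
  sumOn-mono-≤ D {g} {h} g≤h = ∑-mono-≤ pointwise
    where
    pointwise : ∀ j → (if D j then g j else 0ℚ) ≤ (if D j then h j else 0ℚ)
    pointwise j with D j in Dj
    ... | true  = g≤h j Dj
    ... | false = ℚP.≤-refl

  -- Separable functions of a subset

  Separable : ℕ → Set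
  Separable n = Fin n → Bool → ℚ

  eval : ∀ {n} → Separable n → (Fin n → Bool) → ℚ
  eval c X = ∑ (λ j → c j (X j))

  gain : ∀ {n} → Separable n → Fin n → ℚ
  gain c j = c j true - c j false

  eval-[]≔ : ∀ {n} (c : Separable n) X j b → eval c (X [ j ]≔ b) + c j (X j) ≡ eval c X + c j b
  eval-[]≔ {suc n} c X zero b =
    solve 3 (λ x r y → (x :+ r) :+ y := (y :+ r) :+ x) refl (c zero b) (eval (tail c) (tail X)) (c zero (X zero))
  eval-[]≔ {suc n} c X (suc j) b = begin
    c zero (X zero) + eval (tail c) (tail X [ j ]≔ b) + c (suc j) (X (suc j))
      ≡⟨ ℚP.+-assoc (c zero (X zero)) _ _ ⟩
    c zero (X zero) + (eval (tail c) (tail X [ j ]≔ b) + c (suc j) (X (suc j)))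
      ≡⟨ cong (_+_ (c zero (X zero))) (eval-[]≔ (tail c) (tail X) j b) ⟩
    c zero (X zero) + (eval (tail c) (tail X) + c (suc j) b)
      ≡⟨ ℚP.+-assoc (c zero (X zero)) _ _ ⟨
    c zero (X zero) + eval (tail c) (tail X) + c (suc j) b ∎
    where open ≡-Reasoning

  eval-[]≔true : ∀ {n} (c : Separable n) X j → X j ≡ false → eval c (X [ j ]≔ true) ≡ eval c X + gain c j
  eval-[]≔true c X j Xj = begin
    eval c (X [ j ]≔ true)
      ≡⟨ solve 2 (λ s b → s := s :+ b :- b) refl (eval c (X [ j ]≔ true)) (c j false) ⟩
    eval c (X [ j ]≔ true) + c j false - c j false
      ≡⟨ cong (λ b → eval c (X [ j ]≔ true) + c j b - c j false) (sym Xj) ⟩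
    eval c (X [ j ]≔ true) + c j (X j) - c j false
      ≡⟨ cong (_- c j false) (eval-[]≔ c X j true) ⟩
    eval c X + c j true - c j false
      ≡⟨ ℚP.+-assoc (eval c X) (c j true) (- c j false) ⟩
    eval c X + gain c j ∎
    where open ≡-Reasoning

  eval-[]≔false : ∀ {n} (c : Separable n) X j → X j ≡ true → eval c (X [ j ]≔ false) ≡ eval c X - gain c j
  eval-[]≔false c X j Xj = begin
    eval c (X [ j ]≔ false)
      ≡⟨ solve 3 (λ s a b → s := (s :+ a) :- b :- (a :- b)) refl (eval c (X [ j ]≔ false)) (c j true) (c j false) ⟩
    eval c (X [ j ]≔ false) + c j true - c j false - gain c j
      ≡⟨ cong (λ b → eval c (X [ j ]≔ false) + c j b - c j false - gain c j) (sym Xj) ⟩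
    eval c (X [ j ]≔ false) + c j (X j) - c j false - gain c j
      ≡⟨ cong (λ s → s - c j false - gain c j) (eval-[]≔ c X j false) ⟩
    eval c X + c j false - c j false - gain c j
      ≡⟨ solve 3 (λ s b w → s :+ b :- b :- w := s :- w) refl (eval c X) (c j false) (gain c j) ⟩
    eval c X - gain c j ∎
    where open ≡-Reasoning

  eval-∪ : ∀ {n} (c : Separable n) (C D : Fin n → Bool) → Disjoint C D →
    eval c (C ∪ D) ≡ eval c C + sumOn D (gain c)
  eval-∪ c C D disj = trans (∑-cong split) (∑-+ (λ j → c j (C j)) (λ j → if D j then gain c j else 0ℚ))
    where
    split : ∀ j → c j (C j ∨ D j) ≡ c j (C j) + (if D j then gain c j else 0ℚ)
    split j with C j in Cj | D j in Dj
    ... | true  | true  = ⊥-elim (true≢false (trans (sym Dj) (disj j Cj)))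
    ... | true  | false = sym (ℚP.+-identityʳ _)
    ... | false | true  = solve 2 (λ a b → a := b :+ (a :- b)) refl (c j true) (c j false)
    ... | false | false = sym (ℚP.+-identityʳ _)

  eval-exchange : ∀ {n} (c : Separable n) Z {u v} → ¬ (u ≡ v) → Z u ≡ false → Z v ≡ false →
    eval c (Z [ u ]≔ true) + eval c (Z [ v ]≔ true) ≡ eval c Z + eval c ((Z [ u ]≔ true) [ v ]≔ true)
  eval-exchange c Z {u} {v} u≢v u∉Z v∉Z = begin
    eval c (Z [ u ]≔ true) + eval c (Z [ v ]≔ true)
      ≡⟨ cong₂ _+_ (eval-[]≔true c Z u u∉Z) (eval-[]≔true c Z v v∉Z) ⟩
    (eval c Z + gain c u) + (eval c Z + gain c v)
      ≡⟨ solve 3 (λ z a b → (z :+ a) :+ (z :+ b) := z :+ ((z :+ a) :+ b)) refl (eval c Z) (gain c u) (gain c v) ⟩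
    eval c Z + ((eval c Z + gain c u) + gain c v)
      ≡⟨ cong (λ x → eval c Z + (x + gain c v)) (eval-[]≔true c Z u u∉Z) ⟨
    eval c Z + (eval c (Z [ u ]≔ true) + gain c v)
      ≡⟨ cong (_+_ (eval c Z)) (eval-[]≔true c (Z [ u ]≔ true) v (trans (updateAt-minimal v u Z (u≢v ∘ sym)) v∉Z)) ⟨
    eval c Z + eval c ((Z [ u ]≔ true) [ v ]≔ true) ∎
    where open ≡-Reasoning

  sq : ℚ → ℚ
  sq x = x * x

  comparison : ∀ {n} → (Fin n → ℚ) → (Fin n → ℚ) → Separable n
  comparison p q j b = sq (bit b - p j) - sq (bit b - q j)

  gain-comparison : ∀ {n} (p q : Fin n → ℚ) j → gain (comparison p q) j ≡ two * (q j - p j)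
  gain-comparison p q j = solve 2 (λ p q →
      ((con 1ℚ :- p) :* (con 1ℚ :- p) :- (con 1ℚ :- q) :* (con 1ℚ :- q))
      :- ((con 0ℚ :- p) :* (con 0ℚ :- p) :- (con 0ℚ :- q) :* (con 0ℚ :- q))
      := (con 1ℚ :+ con 1ℚ) :* (q :- p)) refl (p j) (q j)

  comparison-combination : ∀ β p a e →
    e * (sq (β - p) - sq (β - (p + a))) + a * (sq (β - p) - sq (β - (p - e))) ≡ - (a * e * (a + e))
  comparison-combination = solve 4 (λ β p a e →
    e :* ((β :- p) :* (β :- p) :- (β :- (p :+ a)) :* (β :- (p :+ a)))
      :+ a :* ((β :- p) :* (β :- p) :- (β :- (p :- e)) :* (β :- (p :- e)))
      := :- (a :* e :* (a :+ e))) refl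

  -- The level set described by c₁ < 0 ∧ c₂ < 0

  record ExactByBoth {n} (k : ℕ) (c₁ c₂ : Separable n) : Set where
    field
      exact   : ∀ X → count X ≡ k → eval c₁ X < 0ℚ × eval c₂ X < 0ℚ
      inexact : ∀ X → ¬ (count X ≡ k) → 0ℚ < eval c₁ X ⊎ 0ℚ < eval c₂ X

  ExactByBoth-swap : ∀ {n k} {c₁ c₂ : Separable n} → ExactByBoth k c₁ c₂ → ExactByBoth k c₂ c₁
  ExactByBoth-swap E = record
    { exact   = λ X count≡k → proj₂ (exact X count≡k) , proj₁ (exact X count≡k)
    ; inexact = λ X count≢k → Data.Sum.swap (inexact X count≢k)
    }
    where open ExactByBoth E

  Oriented : ∀ {n} → Separable n → Separable n → Set
  Oriented c₁ c₂ = ∀ j → 0ℚ < gain c₁ j × gain c₂ j < 0ℚ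

  module _ {n k} {c₁ c₂ : Separable n} (E : ExactByBoth k c₁ c₂) (1≤k : 1 ℕ.≤ k) (k<n : k ℕ.< n) where

    open ExactByBoth E

    some-gain-pos : ∀ j → 0ℚ < gain c₁ j ⊎ 0ℚ < gain c₂ j
    some-gain-pos j with sized-∌ k<n j
    ... | X , count≡k , j∉X with inexact (X [ j ]≔ true) (count-[]≔true-≢ X j count≡k j∉X)
    ...   | inj₁ pos = inj₁ (0<p+q∧p<0⇒0<q (subst (0ℚ <_) (eval-[]≔true c₁ X j j∉X) pos) (proj₁ (exact X count≡k)))
    ...   | inj₂ pos = inj₂ (0<p+q∧p<0⇒0<q (subst (0ℚ <_) (eval-[]≔true c₂ X j j∉X) pos) (proj₂ (exact X count≡k)))

    some-gain-neg : ∀ j → gain c₁ j < 0ℚ ⊎ gain c₂ j < 0ℚ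
    some-gain-neg j with sized-∋ 1≤k (ℕP.<⇒≤ k<n) j
    ... | X , count≡k , j∈X with inexact (X [ j ]≔ false) (count-[]≔false-≢ X j count≡k j∈X)
    ...   | inj₁ pos = inj₁ (0<p-q∧p<0⇒q<0 (subst (0ℚ <_) (eval-[]≔false c₁ X j j∈X) pos) (proj₁ (exact X count≡k)))
    ...   | inj₂ pos = inj₂ (0<p-q∧p<0⇒q<0 (subst (0ℚ <_) (eval-[]≔false c₂ X j j∈X) pos) (proj₂ (exact X count≡k)))

    -- Exchanging i ∈ X for j ∉ X in both orders: the two intermediate sets of sizes k ± 1
    -- are rejected by c₂, yet their c₂-values add up to those of two exact sets.
    gain₁-not-mixed : ∀ i j → 0ℚ < gain c₁ i → gain c₁ j < 0ℚ → ⊥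
    gain₁-not-mixed i j 0<gᵢ gⱼ<0 with i Fin.≟ j
    ... | yes refl = ℚP.<-asym 0<gᵢ gⱼ<0
    ... | no i≢j with sized-∋∌ 1≤k k<n i≢j
    ...   | X , count≡k , i∈X , j∉X = ℚP.<-asym (ℚP.+-mono-< c₂Y>0 c₂Z>0) c₂Y+c₂Z<0
      where
      Y Z X′ : Fin n → Bool
      Y  = X [ j ]≔ true
      Z  = X [ i ]≔ false
      X′ = Z [ j ]≔ true
      j∉Z : Z j ≡ false
      j∉Z = trans (updateAt-minimal j i X (i≢j ∘ sym)) j∉X
      count-X′ : count X′ ≡ k
      count-X′ = trans (count-[]≔true Z j j∉Z) (trans (count-[]≔false X i i∈X) count≡k)
      c₂Y>0 : 0ℚ < eval c₂ Y
      c₂Y>0 with inexact Y (count-[]≔true-≢ X j count≡k j∉X)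
      ... | inj₂ pos = pos
      ... | inj₁ pos = ⊥-elim (ℚP.<-asym pos (subst (_< 0ℚ) (sym (eval-[]≔true c₁ X j j∉X))
                                                   (p<0∧q<0⇒p+q<0 (proj₁ (exact X count≡k)) gⱼ<0)))
      c₂Z>0 : 0ℚ < eval c₂ Z
      c₂Z>0 with inexact Z (count-[]≔false-≢ X i count≡k i∈X)
      ... | inj₂ pos = pos
      ... | inj₁ pos = ⊥-elim (ℚP.<-asym pos (subst (_< 0ℚ) (sym (eval-[]≔false c₁ X i i∈X))
                                                   (p<0∧0<q⇒p-q<0 (proj₁ (exact X count≡k)) 0<gᵢ)))
      exchange : eval c₂ Y + eval c₂ Z ≡ eval c₂ X + eval c₂ X′
      exchange = begin
        eval c₂ Y + eval c₂ Z
          ≡⟨ cong₂ _+_ (eval-[]≔true c₂ X j j∉X) (eval-[]≔false c₂ X i i∈X) ⟩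
        (eval c₂ X + gain c₂ j) + (eval c₂ X - gain c₂ i)
          ≡⟨ solve 3 (λ x a b → (x :+ b) :+ (x :- a) := x :+ ((x :- a) :+ b)) refl (eval c₂ X) (gain c₂ i) (gain c₂ j) ⟩
        eval c₂ X + ((eval c₂ X - gain c₂ i) + gain c₂ j)
          ≡⟨ cong (λ z → eval c₂ X + (z + gain c₂ j)) (eval-[]≔false c₂ X i i∈X) ⟨
        eval c₂ X + (eval c₂ Z + gain c₂ j)
          ≡⟨ cong (_+_ (eval c₂ X)) (eval-[]≔true c₂ Z j j∉Z) ⟨
        eval c₂ X + eval c₂ X′ ∎
        where open ≡-Reasoning
      c₂Y+c₂Z<0 : eval c₂ Y + eval c₂ Z < 0ℚ
      c₂Y+c₂Z<0 = subst (_< 0ℚ) (sym exchange) (p<0∧q<0⇒p+q<0 (proj₂ (exact X count≡k)) (proj₂ (exact X′ count-X′)))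

    oriented : ∀ i → 0ℚ < gain c₁ i → Oriented c₁ c₂
    oriented i 0<gᵢ j with some-gain-neg j
    ... | inj₁ g₁ⱼ<0 = ⊥-elim (gain₁-not-mixed i j 0<gᵢ g₁ⱼ<0)
    ... | inj₂ g₂ⱼ<0 with some-gain-pos j
    ...   | inj₁ 0<g₁ⱼ = 0<g₁ⱼ , g₂ⱼ<0
    ...   | inj₂ 0<g₂ⱼ = ⊥-elim (ℚP.<-asym 0<g₂ⱼ g₂ⱼ<0)

  orientation : ∀ {n k} {c₁ c₂ : Separable n} → ExactByBoth k c₁ c₂ → 1 ℕ.≤ k → k ℕ.< n →
    Oriented c₁ c₂ ⊎ Oriented c₂ c₁
  orientation {suc n} {c₁ = c₁} E 1≤k k<n with 0ℚ ℚP.<? gain c₁ zero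
  ... | yes 0<g₁ = inj₁ (oriented E 1≤k k<n zero 0<g₁)
  ... | no ¬0<g₁ with some-gain-pos E 1≤k k<n zero
  ...   | inj₁ 0<g₁ = ⊥-elim (¬0<g₁ 0<g₁)
  ...   | inj₂ 0<g₂ = inj₂ (oriented (ExactByBoth-swap E) 1≤k k<n zero 0<g₂)

  module _ {n k} {c₁ c₂ : Separable n} (E : ExactByBoth k c₁ c₂) (O : Oriented c₁ c₂) where

    open ExactByBoth E

    adding-rejected-by-c₁ : ∀ X → count X ≡ k → ∀ j → X j ≡ false → 0ℚ < eval c₁ X + gain c₁ j
    adding-rejected-by-c₁ X count≡k j j∉X with inexact (X [ j ]≔ true) (count-[]≔true-≢ X j count≡k j∉X)
    ... | inj₁ pos = subst (0ℚ <_) (eval-[]≔true c₁ X j j∉X) pos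
    ... | inj₂ pos = ⊥-elim (ℚP.<-asym (subst (0ℚ <_) (eval-[]≔true c₂ X j j∉X) pos)
                                       (p<0∧q<0⇒p+q<0 (proj₂ (exact X count≡k)) (proj₂ (O j))))

    removing-rejected-by-c₂ : ∀ X → count X ≡ k → ∀ j → X j ≡ true → 0ℚ < eval c₂ X - gain c₂ j
    removing-rejected-by-c₂ X count≡k j j∈X with inexact (X [ j ]≔ false) (count-[]≔false-≢ X j count≡k j∈X)
    ... | inj₂ pos = subst (0ℚ <_) (eval-[]≔false c₂ X j j∈X) pos
    ... | inj₁ pos = ⊥-elim (ℚP.<-asym (subst (0ℚ <_) (eval-[]≔false c₁ X j j∈X) pos)
                                       (p<0∧0<q⇒p-q<0 (proj₁ (exact X count≡k)) (proj₁ (O j))))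

  -- Nearly constant functions

  module NearlyConstant {n} (h : Fin n → ℚ) (s : ℕ) (γ : ℚ) (0<s : 0 ℕ.< s)
    (gap : ∀ i j → h i < h j → h i + γ ≤ h j)
    (balanced : ∀ D D′ → Disjoint D D′ → count D ≡ s → count D′ ≡ s → sumOn D h - sumOn D′ h < fromℕ s * γ)
    where

    Above Below Off : Fin n → Fin n → Bool
    Above c j = does (h c ℚP.<? h j)
    Below c j = does (h j ℚP.<? h c)
    Off c = Above c ∪ Below c

    ∉Off⇒≡ : ∀ c j → Off c j ≡ false → h j ≡ h c
    ∉Off⇒≡ c j j∉Off = ℚP.≤-antisym
      (ℚP.≮⇒≥ (does-false (h c ℚP.<? h j) (∨-false-l (Above c j) j∉Off)))
      (ℚP.≮⇒≥ (does-false (h j ℚP.<? h c) (∨-false-r (Above c j) j∉Off)))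

    no-gap : ∀ t D D′ → Disjoint D D′ → count D ≡ s → count D′ ≡ s →
      (∀ j → D j ≡ true → t + γ ≤ h j) → (∀ j → D′ j ≡ true → h j ≤ t) → ⊥
    no-gap t D D′ disj count-D count-D′ D≥ D′≤ =
      ℚP.<-irrefl refl (ℚP.<-≤-trans (balanced D D′ disj count-D count-D′) sγ≤)
      where
      D-lower : fromℕ s * (t + γ) ≤ sumOn D h
      D-lower = subst (_≤ sumOn D h) (trans (sumOn-const D (t + γ)) (cong (λ m → fromℕ m * (t + γ)) count-D))
                      (sumOn-mono-≤ D D≥)
      D′-upper : sumOn D′ h ≤ fromℕ s * t
      D′-upper = subst (sumOn D′ h ≤_) (trans (sumOn-const D′ t) (cong (λ m → fromℕ m * t) count-D′))
                       (sumOn-mono-≤ D′ D′≤)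
      sγ≤ : fromℕ s * γ ≤ sumOn D h - sumOn D′ h
      sγ≤ = subst (_≤ sumOn D h - sumOn D′ h) (solve 3 (λ s t g → s :* (t :+ g) :- s :* t := s :* g) refl (fromℕ s) t γ)
                  (ℚP.+-mono-≤ D-lower (ℚP.neg-antimono-≤ D′-upper))

    small-side : ∀ t (P : Fin n → Bool) → (∀ j → P j ≡ true → t + γ ≤ h j) → (∀ j → P j ≡ false → h j ≤ t) →
      count P ℕ.< s ⊎ count (∁ P) ℕ.< s
    small-side t P P≥ ∁P≤ with count P ℕ.<? s | count (∁ P) ℕ.<? s
    ... | yes P<s | _         = inj₁ P<s
    ... | no  _   | yes ∁P<s  = inj₂ ∁P<s
    ... | no  P≮s | no  ∁P≮s with sized-⊆ P (ℕP.≮⇒≥ P≮s) | sized-⊆ (∁ P) (ℕP.≮⇒≥ ∁P≮s)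
    ...   | D , count-D , D⊆P | D′ , count-D′ , D′⊆∁P =
      ⊥-elim (no-gap t D D′ disj count-D count-D′ (λ j → P≥ j ∘ D⊆P j) (λ j → ∁P≤ j ∘ not-true ∘ D′⊆∁P j))
      where
      disj : Disjoint D D′
      disj j Dj with D′ j in D′j
      ... | false = refl
      ... | true  = ⊥-elim (true≢false (trans (sym (D⊆P j Dj)) (not-true (D′⊆∁P j D′j))))

    few-above : ∀ c → count (Above c) ℕ.< s ⊎ count (∁ (Above c)) ℕ.< s
    few-above c = small-side (h c) (Above c) (λ j → gap c j ∘ does-true (h c ℚP.<? h j))
                                             (λ j → ℚP.≮⇒≥ ∘ does-false (h c ℚP.<? h j))

    few-below : ∀ c → count (∁ (Below c)) ℕ.< s ⊎ count (Below c) ℕ.< s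
    few-below c = Data.Sum.map₂ (subst (ℕ._< s) (count-cong (λ j → not-involutive (Below c j))))
                                (small-side (h c - γ) (∁ (Below c)) upper lower)
      where
      upper : ∀ j → ∁ (Below c) j ≡ true → (h c - γ) + γ ≤ h j
      upper j j∉Below = subst (_≤ h j) (solve 2 (λ x g → x := (x :- g) :+ g) refl (h c) γ)
                          (ℚP.≮⇒≥ (does-false (h j ℚP.<? h c) (not-true j∉Below)))
      lower : ∀ j → ∁ (Below c) j ≡ false → h j ≤ h c - γ
      lower j j∈Below = 0≤q-p⇒p≤q (subst (0ℚ ≤_) (solve 3 (λ a b g → b :- (a :+ g) := (b :- g) :- a) refl (h j) (h c) γ)
                          (p≤q⇒0≤q-p (gap j c (does-true (h j ℚP.<? h c) (not-false j∈Below)))))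

    Top Bottom : Fin n → Bool
    Top    c = does (count (∁ (Below c)) ℕ.<? s)
    Bottom c = does (count (∁ (Above c)) ℕ.<? s)

    count-Top<s : count Top ℕ.< s
    count-Top<s with minimum ℚP.≤-refl ℚP.≤-trans ℚP.≤-total Top h
    ... | inj₁ empty = subst (ℕ._< s) (sym (trans (count-cong empty) (count-∅ {n}))) 0<s
    ... | inj₂ (m , m∈Top , min) = ℕP.≤-<-trans (count-mono Top⊆) (does-true (count (∁ (Below m)) ℕ.<? s) m∈Top)
      where
      Top⊆ : Top ⊆ ∁ (Below m)
      Top⊆ j j∈Top = cong not (dec-false (h j ℚP.<? h m) (≤⇒≯ (min j j∈Top)))

    count-Bottom<s : count Bottom ℕ.< s
    count-Bottom<s
      with minimum ℚP.≤-refl (λ x≥y y≥z → ℚP.≤-trans y≥z x≥y) (λ x y → Data.Sum.swap (ℚP.≤-total x y)) Bottom h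
    ... | inj₁ empty = subst (ℕ._< s) (sym (trans (count-cong empty) (count-∅ {n}))) 0<s
    ... | inj₂ (m , m∈Bottom , max) = ℕP.≤-<-trans (count-mono Bottom⊆) (does-true (count (∁ (Above m)) ℕ.<? s) m∈Bottom)
      where
      Bottom⊆ : Bottom ⊆ ∁ (Above m)
      Bottom⊆ j j∈Bottom = cong not (dec-false (h m ℚP.<? h j) (≤⇒≯ (max j j∈Bottom)))

    nearly-constant : s ℕ.+ s ℕ.≤ n → ∃[ c ] count (Off c) ℕ.< s ℕ.+ s
    nearly-constant 2s≤n
      with count<n⇒∃false (Top ∪ Bottom)
             (ℕP.<-≤-trans (ℕP.≤-<-trans (count-∪-≤ Top Bottom) (ℕP.+-mono-< count-Top<s count-Bottom<s)) 2s≤n)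
    ... | c , c∉Top∪Bottom = c , ℕP.≤-<-trans (count-∪-≤ (Above c) (Below c)) (ℕP.+-mono-< above below)
      where
      s≤∁Below : s ℕ.≤ count (∁ (Below c))
      s≤∁Below = ℕP.≮⇒≥ ∁Below≮s
        where
        ∁Below≮s : ¬ (count (∁ (Below c)) ℕ.< s)
        ∁Below≮s = does-false (count (∁ (Below c)) ℕ.<? s) (∨-false-l (Top c) c∉Top∪Bottom)
      s≤∁Above : s ℕ.≤ count (∁ (Above c))
      s≤∁Above = ℕP.≮⇒≥ ∁Above≮s
        where
        ∁Above≮s : ¬ (count (∁ (Above c)) ℕ.< s)
        ∁Above≮s = does-false (count (∁ (Above c)) ℕ.<? s) (∨-false-r (Top c) c∉Top∪Bottom)
      above : count (Above c) ℕ.< s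
      above = Data.Sum.[ id , (λ small → ⊥-elim (ℕP.<⇒≱ small s≤∁Above)) ]′ (few-above c)
      below : count (Below c) ℕ.< s
      below = Data.Sum.[ (λ small → ⊥-elim (ℕP.<⇒≱ small s≤∁Below)) , id ]′ (few-below c)

  -- Bounded denominators

  recip : ℕ → ℚ
  recip d = mkℚ (+ 1) d (1-coprimeTo (suc d))

  0<recip : ∀ d → 0ℚ < recip d
  0<recip d = ℚ.*<* (ℤ.+<+ (s≤s z≤n))

  fromℕ-suc*recip : ∀ d → fromℕ (suc d) * recip d ≡ 1ℚ
  fromℕ-suc*recip d = ℚP.*-inverseʳ (fromℕ (suc d))

  recip≤pos : ∀ x d → 0ℚ < x → ↧ₙ x ℕ.≤ suc d → recip d ≤ x
  recip≤pos (mkℚ +[1+ m ] e _) d _ e<d = ℚ.*≤* (subst₂ ℤ._≤_ (sym (ℤP.*-identityˡ (+ suc e))) (ℤP.pos-* (suc m) (suc d))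
                                          (ℤ.+≤+ (ℕP.≤-trans e<d (ℕP.m≤n*m (suc d) (suc m)))))
  recip≤pos (mkℚ (+ zero) e _) d (ℚ.*<* (ℤ.+<+ ())) _
  recip≤pos (mkℚ -[1+ m ] e _) d (ℚ.*<* ()) _

  ↧ₙ-+ : ∀ p q → ↧ₙ (p + q) ℕ.≤ ↧ₙ p ℕ.* ↧ₙ q
  ↧ₙ-+ p q = divides-≤ (trans (ℚP.↧-+ p q) (sym (ℤP.pos-* (↧ₙ p) (↧ₙ q))))
    where
    divides-≤ : ∀ {a b : ℕ} {z : ℤ} → (+ a) ℤ.* z ≡ + suc b → a ℕ.≤ suc b
    divides-≤ {a} {b} {z} eq with ℤ.∣ z ∣ | trans (sym (ℤP.abs-* (+ a) z)) (cong ℤ.∣_∣ eq)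
    ... | suc m | a*m≡b = subst (a ℕ.≤_) a*m≡b (ℕP.m≤m*n a (suc m))
    ... | zero  | a*0≡b = ⊥-elim (ℕP.0≢1+n (trans (sym (ℕP.*-zeroʳ a)) a*0≡b))

  ↧ₙ-- : ∀ p q → ↧ₙ (p - q) ℕ.≤ ↧ₙ p ℕ.* ↧ₙ q
  ↧ₙ-- p q = subst (λ d → ↧ₙ (p - q) ℕ.≤ ↧ₙ p ℕ.* d) (ℤP.+-injective (ℚP.↧-neg q)) (↧ₙ-+ p (- q))

  ∣↥p∣≤N⇒∣p∣≤N : ∀ p N → ℤ.∣ ↥ p ∣ ℕ.≤ N → ∣ p ∣ ≤ fromℕ N
  ∣↥p∣≤N⇒∣p∣≤N (mkℚ m e _) N m≤N = ℚ.*≤* (subst₂ ℤ._≤_ (sym (ℤP.*-identityʳ (+ ℤ.∣ m ∣))) (ℤP.pos-* N (suc e))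
                                 (ℤ.+≤+ (ℕP.≤-trans m≤N (ℕP.m≤m*n N (suc e)))))

  m≤2^⌈log2⌉m : ∀ m (a : Acc ℕ._<_ m) → m ℕ.≤ 2 ^ ⌈log2⌉ m a
  m≤2^⌈log2⌉m zero          _        = z≤n
  m≤2^⌈log2⌉m (suc zero)    _        = s≤s z≤n
  m≤2^⌈log2⌉m (suc (suc n)) (acc rs) = ℕP.≤-trans 2+n≤ (ℕP.*-monoʳ-≤ 2 (m≤2^⌈log2⌉m (suc ℕ.⌈ n /2⌉) _))
    where
    open ℕP.≤-Reasoning
    2+n≤ : 2 ℕ.+ n ℕ.≤ 2 ℕ.* suc ℕ.⌈ n /2⌉
    2+n≤ = begin
      2 ℕ.+ n                            ≡⟨ cong (2 ℕ.+_) (ℕP.⌊n/2⌋+⌈n/2⌉≡n n) ⟨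
      2 ℕ.+ (ℕ.⌊ n /2⌋ ℕ.+ ℕ.⌈ n /2⌉)   ≤⟨ ℕP.+-monoʳ-≤ 2 (ℕP.+-monoˡ-≤ ℕ.⌈ n /2⌉ (ℕP.⌊n/2⌋≤⌈n/2⌉ n)) ⟩
      2 ℕ.+ (ℕ.⌈ n /2⌉ ℕ.+ ℕ.⌈ n /2⌉)   ≡⟨ cong (λ y → 2 ℕ.+ (ℕ.⌈ n /2⌉ ℕ.+ y)) (ℕP.+-identityʳ ℕ.⌈ n /2⌉) ⟨
      2 ℕ.+ 2 ℕ.* ℕ.⌈ n /2⌉              ≡⟨ ℕP.*-suc 2 ℕ.⌈ n /2⌉ ⟨
      2 ℕ.* suc ℕ.⌈ n /2⌉               ∎

  ⌈log₂⌉≤⇒≤2^ : ∀ m R → ⌈log₂ m ⌉ ℕ.≤ R → m ℕ.≤ 2 ^ R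
  ⌈log₂⌉≤⇒≤2^ m R h = ℕP.≤-trans (m≤2^⌈log2⌉m m (<-wellFounded m)) (ℕP.^-monoʳ-≤ 2 h)

  Bounded : ℕ → ℕ → ℚ → Set
  Bounded B M x = ↧ₙ x ℕ.≤ B × ∣ x ∣ ≤ fromℕ M

  module _ {B M : ℕ} where

    x-y≤M+M : ∀ {x y} → Bounded B M x → Bounded B M y → x - y ≤ fromℕ (M ℕ.+ M)
    x-y≤M+M {x} {y} (_ , ∣x∣≤M) (_ , ∣y∣≤M) =
      subst (x - y ≤_) (sym (fromℕ-+ M M)) (ℚP.≤-trans (p≤∣p∣ (x - y)) (∣p-q∣≤ ∣x∣≤M ∣y∣≤M))

    sq[bit-x]≤ : ∀ β {x} → Bounded B M x → sq (bit β - x) ≤ fromℕ ((1 ℕ.+ M) ℕ.* (1 ℕ.+ M))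
    sq[bit-x]≤ β (_ , ∣x∣≤M) = subst (_ ≤_) (sym (fromℕ-* (1 ℕ.+ M) (1 ℕ.+ M)))
      (∣p∣≤q⇒p*p≤q*q (subst (_ ≤_) (sym (fromℕ-+ 1 M)) (∣p-q∣≤ (∣bit∣≤1 β) ∣x∣≤M)))

    comparison≤ : ∀ β {x y} → Bounded B M x → Bounded B M y →
      sq (bit β - x) - sq (bit β - y) ≤ fromℕ ((1 ℕ.+ M) ℕ.* (1 ℕ.+ M))
    comparison≤ β {x} {y} bx _ = 0≤q-p⇒p≤q (subst (0ℚ ≤_)
      (solve 3 (λ a b c → (c :- a) :+ b := c :- (a :- b)) refl (sq (bit β - x)) (sq (bit β - y)) (fromℕ ((1 ℕ.+ M) ℕ.* (1 ℕ.+ M))))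
      (ℚP.+-mono-≤ (p≤q⇒0≤q-p (sq[bit-x]≤ β bx)) (0≤p*p (bit β - y))))

  module _ (b : ℕ) where

    private
      B : ℕ
      B = suc b

    D⁴ : ℕ
    D⁴ = B ℕ.* B ℕ.* (B ℕ.* B)

    γ : ℚ
    γ = recip (ℕ.pred D⁴)

    γ≤δ : ∀ {x y M} → Bounded B M x → Bounded B M y → 0ℚ < x - y → γ ≤ x - y
    γ≤δ {x} {y} (↧x≤B , _) (↧y≤B , _) 0<x-y = recip≤pos (x - y) (ℕ.pred D⁴) 0<x-y
      (ℕP.≤-trans (↧ₙ-- x y) (ℕP.≤-trans (ℕP.*-mono-≤ ↧x≤B ↧y≤B) (ℕP.m≤m*n (B ℕ.* B) (B ℕ.* B))))

    δ-gap : ∀ {x y z w M} → Bounded B M x → Bounded B M y → Bounded B M z → Bounded B M w →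
      z - w < x - y → (z - w) + γ ≤ x - y
    δ-gap {x} {y} {z} {w} (↧x , _) (↧y , _) (↧z , _) (↧w , _) lt = 0≤q-p⇒p≤q (subst (0ℚ ≤_)
      (solve 3 (λ u v g → (v :- u) :- g := v :- (u :+ g)) refl (z - w) (x - y) γ)
      (p≤q⇒0≤q-p (recip≤pos ((x - y) - (z - w)) (ℕ.pred D⁴) (p<q⇒0<q-p lt)
        (ℕP.≤-trans (↧ₙ-- (x - y) (z - w))
          (ℕP.*-mono-≤ (ℕP.≤-trans (↧ₙ-- x y) (ℕP.*-mono-≤ ↧x ↧y)) (ℕP.≤-trans (↧ₙ-- z w) (ℕP.*-mono-≤ ↧z ↧w)))))))

    fromℕ-D⁴*γ : fromℕ D⁴ * γ ≡ 1ℚ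
    fromℕ-D⁴*γ = fromℕ-suc*recip (ℕ.pred D⁴)

    fromℕ*γ³<⇒< : ∀ x y → fromℕ x * (γ * γ * γ) < fromℕ y → x ℕ.< y ℕ.* (D⁴ ℕ.* D⁴ ℕ.* D⁴)
    fromℕ*γ³<⇒< x y lt = fromℕ-cancel-< (subst₂ _<_ lhs rhs (ℚP.*-monoˡ-<-pos P {{ℚ.positive 0<P}} lt))
      where
      P : ℚ
      P = fromℕ D⁴ * fromℕ D⁴ * fromℕ D⁴
      0<P : 0ℚ < P
      0<P = *-pos (*-pos 0<D⁴ 0<D⁴) 0<D⁴
        where
        0<D⁴ : 0ℚ < fromℕ D⁴
        0<D⁴ = fromℕ-mono-< (s≤s z≤n)
      lhs : fromℕ x * (γ * γ * γ) * P ≡ fromℕ x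
      lhs = begin
        fromℕ x * (γ * γ * γ) * P
          ≡⟨ solve 3 (λ x g d → x :* (g :* g :* g) :* (d :* d :* d) := x :* (d :* g) :* (d :* g) :* (d :* g))
                     refl (fromℕ x) γ (fromℕ D⁴) ⟩
        fromℕ x * (fromℕ D⁴ * γ) * (fromℕ D⁴ * γ) * (fromℕ D⁴ * γ)
          ≡⟨ cong (λ u → fromℕ x * u * u * u) fromℕ-D⁴*γ ⟩
        fromℕ x * 1ℚ * 1ℚ * 1ℚ
          ≡⟨ solve 1 (λ x → x :* con 1ℚ :* con 1ℚ :* con 1ℚ := x) refl (fromℕ x) ⟩
        fromℕ x ∎
        where open ≡-Reasoning
      rhs : fromℕ y * P ≡ fromℕ (y ℕ.* (D⁴ ℕ.* D⁴ ℕ.* D⁴))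
      rhs = sym (trans (fromℕ-* y (D⁴ ℕ.* D⁴ ℕ.* D⁴))
                  (cong (fromℕ y *_) (trans (fromℕ-* (D⁴ ℕ.* D⁴) D⁴) (cong (_* fromℕ D⁴) (fromℕ-* D⁴ D⁴)))))

  -- One positive and two negative anchors

  -- For entries bounded by M with denominators at most B = suc b: s is the size of the padding sets, K bounds
  -- each term of δ₂·c₁ + δ₁·c₂, W the correction term, and Bound = 4s + (4s·K + W)·B¹².
  module Constants (b M : ℕ) where

    s K W Bound : ℕ
    s = (M ℕ.+ M) ℕ.* D⁴ b
    K = (M ℕ.+ M) ℕ.* ((1 ℕ.+ M) ℕ.* (1 ℕ.+ M)) ℕ.+ (M ℕ.+ M) ℕ.* ((1 ℕ.+ M) ℕ.* (1 ℕ.+ M))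
    W = (M ℕ.+ M) ℕ.* (2 ℕ.* (M ℕ.+ M)) ℕ.+ (M ℕ.+ M) ℕ.* (2 ℕ.* (M ℕ.+ M))
    Bound = (s ℕ.+ s ℕ.+ (s ℕ.+ s)) ℕ.+ ((s ℕ.+ s ℕ.+ (s ℕ.+ s)) ℕ.* K ℕ.+ W) ℕ.* (D⁴ b ℕ.* D⁴ b ℕ.* D⁴ b)

  module SinglePositive {n k} (p q₁ q₂ : Fin n → ℚ) (b M : ℕ)
    (E : ExactByBoth k (comparison p q₁) (comparison p q₂))
    (O : Oriented (comparison p q₁) (comparison p q₂))
    (k<n : k ℕ.< n) (1≤M : 1 ℕ.≤ M)
    (p-bounded : ∀ j → Bounded (suc b) M (p j))
    (q₁-bounded : ∀ j → Bounded (suc b) M (q₁ j))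
    (q₂-bounded : ∀ j → Bounded (suc b) M (q₂ j))
    where

    open ExactByBoth E
    open Constants b M

    c₁ c₂ : Separable n
    c₁ = comparison p q₁
    c₂ = comparison p q₂

    δ₁ δ₂ : Fin n → ℚ
    δ₁ j = q₁ j - p j
    δ₂ j = p j - q₂ j

    0<s : 0 ℕ.< s
    0<s = ℕP.*-mono-≤ (ℕP.≤-trans 1≤M (ℕP.m≤m+n M M)) (s≤s z≤n)

    gain₁ : ∀ j → gain c₁ j ≡ two * δ₁ j
    gain₁ = gain-comparison p q₁

    gain₂ : ∀ j → gain c₂ j ≡ - (two * δ₂ j)
    gain₂ j = trans (gain-comparison p q₂ j) (solve 2 (λ x y → con two :* (y :- x) := :- (con two :* (x :- y))) refl (p j) (q₂ j))

    0<δ₁ : ∀ j → 0ℚ < δ₁ j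
    0<δ₁ j = two*-cancel-< (subst₂ _<_ (sym (ℚP.*-zeroʳ two)) (gain₁ j) (proj₁ (O j)))

    0<δ₂ : ∀ j → 0ℚ < δ₂ j
    0<δ₂ j = two*-cancel-< (subst₂ _<_ (sym (ℚP.*-zeroʳ two)) (solve 1 (λ x → :- (:- x) := x) refl (two * δ₂ j))
               (neg<0⇒0<- (subst (_< 0ℚ) (gain₂ j) (proj₂ (O j)))))

    δ₁-gap : ∀ i j → δ₁ i < δ₁ j → δ₁ i + γ b ≤ δ₁ j
    δ₁-gap i j = δ-gap b (q₁-bounded j) (p-bounded j) (q₁-bounded i) (p-bounded i)

    δ₂-gap : ∀ i j → δ₂ i < δ₂ j → δ₂ i + γ b ≤ δ₂ j
    δ₂-gap i j = δ-gap b (p-bounded j) (q₂-bounded j) (p-bounded i) (q₂-bounded i)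

    s*γ≡M+M : fromℕ s * γ b ≡ fromℕ (M ℕ.+ M)
    s*γ≡M+M = begin
      fromℕ ((M ℕ.+ M) ℕ.* D⁴ b) * γ b        ≡⟨ cong (_* γ b) (fromℕ-* (M ℕ.+ M) (D⁴ b)) ⟩
      fromℕ (M ℕ.+ M) * fromℕ (D⁴ b) * γ b    ≡⟨ ℚP.*-assoc (fromℕ (M ℕ.+ M)) (fromℕ (D⁴ b)) (γ b) ⟩
      fromℕ (M ℕ.+ M) * (fromℕ (D⁴ b) * γ b)  ≡⟨ cong (fromℕ (M ℕ.+ M) *_) (fromℕ-D⁴*γ b) ⟩
      fromℕ (M ℕ.+ M) * 1ℚ                    ≡⟨ ℚP.*-identityʳ (fromℕ (M ℕ.+ M)) ⟩
      fromℕ (M ℕ.+ M)                         ∎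
      where open ≡-Reasoning

    eval-∪-difference : ∀ c {C D D′ : Fin n → Bool} → Disjoint C D → Disjoint C D′ →
      eval c (C ∪ D) - eval c (C ∪ D′) ≡ sumOn D (gain c) - sumOn D′ (gain c)
    eval-∪-difference c {C} {D} {D′} C∩D=∅ C∩D′=∅ =
      trans (cong₂ _-_ (eval-∪ c C D C∩D=∅) (eval-∪ c C D′ C∩D′=∅))
            (solve 3 (λ x u v → (x :+ u) :- (x :+ v) := u :- v) refl (eval c C) (sumOn D (gain c)) (sumOn D′ (gain c)))

    sumOn-gain₁ : ∀ D → sumOn D (gain c₁) ≡ two * sumOn D δ₁
    sumOn-gain₁ D = trans (sumOn-cong D gain₁) (sumOn-* D two δ₁)

    sumOn-gain₂ : ∀ D → sumOn D (gain c₂) ≡ - (two * sumOn D δ₂)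
    sumOn-gain₂ D = trans (sumOn-cong D (λ j → trans (gain₂ j) (ℚP.neg-distribˡ-* two (δ₂ j))))
                          (trans (sumOn-* D (- two) δ₂) (sym (ℚP.neg-distribˡ-* two (sumOn D δ₂))))

    module Balanced (s≤k : s ℕ.≤ k) (k+s≤n : k ℕ.+ s ℕ.≤ n) where

      Padding : (D D′ : Fin n → Bool) → Set
      Padding D D′ = Σ[ C ∈ (Fin n → Bool) ] (count C ≡ k ℕ.∸ s × Disjoint C D × Disjoint C D′)

      padding : ∀ D D′ → Disjoint D D′ → count D ≡ s → count D′ ≡ s → Padding D D′
      padding D D′ disj count-D count-D′
        with extend ∅ (D ∪ D′) (k ℕ.∸ s) (λ _ ()) (subst (ℕ._≤ k ℕ.∸ s) (sym (count-∅ {n})) z≤n) room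
        where
        room : k ℕ.∸ s ℕ.+ count (D ∪ D′) ℕ.≤ n
        room = subst (λ m → k ℕ.∸ s ℕ.+ m ℕ.≤ n)
                 (sym (trans (count-∪-disjoint D D′ disj) (cong₂ ℕ._+_ count-D count-D′)))
                 (subst (ℕ._≤ n) (trans (cong (ℕ._+ s) (sym (ℕP.m∸n+n≡m s≤k))) (ℕP.+-assoc (k ℕ.∸ s) s s)) k+s≤n)
      ... | C , count-C , _ , D∪D′∩C=∅ =
        C , count-C , Disjoint-sym (λ j → D∪D′∩C=∅ j ∘ ∨-true-l) , Disjoint-sym (λ j → D∪D′∩C=∅ j ∘ ∨-true-r (D j))

      count-padded : ∀ {C D : Fin n → Bool} → Disjoint C D → count C ≡ k ℕ.∸ s → count D ≡ s → count (C ∪ D) ≡ k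
      count-padded {C} {D} disj count-C count-D =
        trans (count-∪-disjoint C D disj) (trans (cong₂ ℕ._+_ count-C count-D) (ℕP.m∸n+n≡m s≤k))

      balanced₁ : ∀ D D′ → Disjoint D D′ → count D ≡ s → count D′ ≡ s → sumOn D δ₁ - sumOn D′ δ₁ < fromℕ s * γ b
      balanced₁ D D′ disj count-D count-D′ with padding D D′ disj count-D count-D′
      ... | C , count-C , C∩D=∅ , C∩D′=∅
        with count<n⇒∃false (C ∪ D′) (subst (ℕ._< n) (sym (count-padded C∩D′=∅ count-C count-D′)) k<n)
      ...   | j , j∉X′ = subst (sumOn D δ₁ - sumOn D′ δ₁ <_) (sym s*γ≡M+M)
                             (ℚP.<-≤-trans diff<δ₁ⱼ (x-y≤M+M (q₁-bounded j) (p-bounded j)))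
        where
        X X′ : Fin n → Bool
        X  = C ∪ D
        X′ = C ∪ D′
        diff<gain : eval c₁ X - eval c₁ X′ < gain c₁ j
        diff<gain = 0<q-p⇒p<q (subst (0ℚ <_)
                      (solve 3 (λ x x′ g → (x′ :+ g) :+ (:- x) := g :- (x :- x′)) refl (eval c₁ X) (eval c₁ X′) (gain c₁ j))
                      (ℚP.+-mono-< (adding-rejected-by-c₁ E O X′ (count-padded C∩D′=∅ count-C count-D′) j j∉X′)
                                   (neg<0⇒0<- (proj₁ (exact X (count-padded C∩D=∅ count-C count-D))))))
        diff<δ₁ⱼ : sumOn D δ₁ - sumOn D′ δ₁ < δ₁ j
        diff<δ₁ⱼ = two*-cancel-< (subst₂ _<_ (begin
            eval c₁ X - eval c₁ X′                             ≡⟨ eval-∪-difference c₁ C∩D=∅ C∩D′=∅ ⟩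
            sumOn D (gain c₁) - sumOn D′ (gain c₁)             ≡⟨ cong₂ _-_ (sumOn-gain₁ D) (sumOn-gain₁ D′) ⟩
            two * sumOn D δ₁ - two * sumOn D′ δ₁
              ≡⟨ solve 2 (λ u v → con two :* u :- con two :* v := con two :* (u :- v)) refl (sumOn D δ₁) (sumOn D′ δ₁) ⟩
            two * (sumOn D δ₁ - sumOn D′ δ₁)                    ∎) (gain₁ j) diff<gain)
          where open ≡-Reasoning

      balanced₂ : ∀ D D′ → Disjoint D D′ → count D ≡ s → count D′ ≡ s → sumOn D δ₂ - sumOn D′ δ₂ < fromℕ s * γ b
      balanced₂ D D′ disj count-D count-D′ with padding D D′ disj count-D count-D′
      ... | C , count-C , C∩D=∅ , C∩D′=∅
        with 0<count⇒∃true (C ∪ D) (subst (0 ℕ.<_) (sym (count-padded C∩D=∅ count-C count-D)) (ℕP.<-≤-trans 0<s s≤k))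
      ...   | i , i∈X = subst (sumOn D δ₂ - sumOn D′ δ₂ <_) (sym s*γ≡M+M)
                            (ℚP.<-≤-trans diff<δ₂ᵢ (x-y≤M+M (p-bounded i) (q₂-bounded i)))
        where
        X X′ : Fin n → Bool
        X  = C ∪ D
        X′ = C ∪ D′
        diff<-gain : eval c₂ X′ - eval c₂ X < - gain c₂ i
        diff<-gain = 0<q-p⇒p<q (subst (0ℚ <_)
                       (solve 3 (λ x x′ g → (x :- g) :+ (:- x′) := (:- g) :- (x′ :- x)) refl (eval c₂ X) (eval c₂ X′) (gain c₂ i))
                       (ℚP.+-mono-< (removing-rejected-by-c₂ E O X (count-padded C∩D=∅ count-C count-D) i i∈X)
                                    (neg<0⇒0<- (proj₂ (exact X′ (count-padded C∩D′=∅ count-C count-D′))))))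
        diff<δ₂ᵢ : sumOn D δ₂ - sumOn D′ δ₂ < δ₂ i
        diff<δ₂ᵢ = two*-cancel-< (subst₂ _<_ (begin
            eval c₂ X′ - eval c₂ X                             ≡⟨ eval-∪-difference c₂ C∩D′=∅ C∩D=∅ ⟩
            sumOn D′ (gain c₂) - sumOn D (gain c₂)             ≡⟨ cong₂ _-_ (sumOn-gain₂ D′) (sumOn-gain₂ D) ⟩
            - (two * sumOn D′ δ₂) - - (two * sumOn D δ₂)
              ≡⟨ solve 2 (λ u v → :- (con two :* v) :- :- (con two :* u) := con two :* (u :- v)) refl (sumOn D δ₂) (sumOn D′ δ₂) ⟩
            two * (sumOn D δ₂ - sumOn D′ δ₂)                    ∎)
          (trans (cong -_ (gain₂ i)) (solve 1 (λ x → :- (:- x) := x) refl (two * δ₂ i))) diff<-gain)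
          where open ≡-Reasoning

      module N₁ = NearlyConstant δ₁ s (γ b) 0<s δ₁-gap balanced₁
      module N₂ = NearlyConstant δ₂ s (γ b) 0<s δ₂-gap balanced₂

      module Centred (c c′ : Fin n) where

        a e mm : ℚ
        a  = δ₁ c
        e  = δ₂ c′
        mm = a * e * (a + e)

        Irregular : Fin n → Bool
        Irregular = N₁.Off c ∪ N₂.Off c′

        T : Separable n
        T j β = e * c₁ j β + a * c₂ j β

        eval-T : ∀ X → eval T X ≡ e * eval c₁ X + a * eval c₂ X
        eval-T X = trans (∑-+ (λ j → e * c₁ j (X j)) (λ j → a * c₂ j (X j)))
                         (cong₂ _+_ (∑-* e (λ j → c₁ j (X j))) (∑-* a (λ j → c₂ j (X j))))

        T-regular : ∀ j β → Irregular j ≡ false → T j β ≡ - mm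
        T-regular j β regular = trans
          (cong₂ (λ u v → e * (sq (bit β - p j) - sq (bit β - u)) + a * (sq (bit β - p j) - sq (bit β - v))) q₁≡ q₂≡)
          (comparison-combination (bit β) (p j) a e)
          where
          q₁≡ : q₁ j ≡ p j + a
          q₁≡ = trans (solve 2 (λ x y → y := x :+ (y :- x)) refl (p j) (q₁ j))
                      (cong (_+_ (p j)) (N₁.∉Off⇒≡ c j (∨-false-l (N₁.Off c j) regular)))
          q₂≡ : q₂ j ≡ p j - e
          q₂≡ = trans (solve 2 (λ x y → y := x :- (x :- y)) refl (p j) (q₂ j))
                      (cong (_-_ (p j)) (N₂.∉Off⇒≡ c′ j (∨-false-r (N₁.Off c j) regular)))

        T≤K : ∀ j β → T j β ≤ fromℕ K
        T≤K j β = ≤fromℕ-+ _ _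
          (≤fromℕ-* _ _ (ℚP.<⇒≤ (0<δ₂ c′)) (x-y≤M+M (p-bounded c′) (q₂-bounded c′)) (comparison≤ β (p-bounded j) (q₁-bounded j)))
          (≤fromℕ-* _ _ (ℚP.<⇒≤ (0<δ₁ c)) (x-y≤M+M (q₁-bounded c) (p-bounded c)) (comparison≤ β (p-bounded j) (q₂-bounded j)))

        eval-T≤ : ∀ X → eval T X ≤ fromℕ (count Irregular) * fromℕ K + fromℕ (count (∁ Irregular)) * (- mm)
        eval-T≤ X = subst (eval T X ≤_) (∑-if Irregular (fromℕ K) (- mm)) (∑-mono-≤ pointwise)
          where
          pointwise : ∀ j → T j (X j) ≤ (if Irregular j then fromℕ K else - mm)
          pointwise j with Irregular j in irregular
          ... | true  = T≤K j (X j)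
          ... | false = ℚP.≤-reflexive (T-regular j (X j) irregular)

        correction : Fin n → Fin n → ℚ
        correction i j = e * (two * δ₁ j) + a * (two * δ₂ i)

        correction≤W : ∀ i j → correction i j ≤ fromℕ W
        correction≤W i j = ≤fromℕ-+ _ _
          (≤fromℕ-* _ _ (ℚP.<⇒≤ (0<δ₂ c′)) (x-y≤M+M (p-bounded c′) (q₂-bounded c′)) (two*≤ (x-y≤M+M (q₁-bounded j) (p-bounded j))))
          (≤fromℕ-* _ _ (ℚP.<⇒≤ (0<δ₁ c)) (x-y≤M+M (q₁-bounded c) (p-bounded c)) (two*≤ (x-y≤M+M (p-bounded i) (q₂-bounded i))))
          where
          two*≤ : ∀ {x} → x ≤ fromℕ (M ℕ.+ M) → two * x ≤ fromℕ (2 ℕ.* (M ℕ.+ M))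
          two*≤ = ≤fromℕ-* 2 (M ℕ.+ M) (ℚP.<⇒≤ 0<two) (ℚP.≤-reflexive (sym (fromℕ-+ 1 1)))

        exact-lower : ∀ X → count X ≡ k → ∀ i j → X i ≡ true → X j ≡ false → 0ℚ < eval T X + correction i j
        exact-lower X count≡k i j i∈X j∉X = subst (0ℚ <_) combined
          (ℚP.+-mono-< (*-pos (0<δ₂ c′) (adding-rejected-by-c₁ E O X count≡k j j∉X))
                       (*-pos (0<δ₁ c) (removing-rejected-by-c₂ E O X count≡k i i∈X)))
          where
          open ≡-Reasoning
          combined : e * (eval c₁ X + gain c₁ j) + a * (eval c₂ X - gain c₂ i) ≡ eval T X + correction i j
          combined = begin
            e * (eval c₁ X + gain c₁ j) + a * (eval c₂ X - gain c₂ i)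
              ≡⟨ cong₂ (λ u v → e * (eval c₁ X + u) + a * (eval c₂ X - v)) (gain₁ j) (gain₂ i) ⟩
            e * (eval c₁ X + two * δ₁ j) + a * (eval c₂ X - - (two * δ₂ i))
              ≡⟨ solve 6 (λ e a x y u v → e :* (x :+ u) :+ a :* (y :- (:- v)) := (e :* x :+ a :* y) :+ (e :* u :+ a :* v))
                   refl e a (eval c₁ X) (eval c₂ X) (two * δ₁ j) (two * δ₂ i) ⟩
            (e * eval c₁ X + a * eval c₂ X) + correction i j
              ≡⟨ cong (_+ correction i j) (eval-T X) ⟨
            eval T X + correction i j ∎

        γ³≤mm : γ b * γ b * γ b ≤ mm
        γ³≤mm = *-mono-≤ (*-nonNeg 0≤γ 0≤γ) (*-mono-≤ 0≤γ γ≤a γ≤e 0≤e) γ≤a+e (ℚP.+-mono-≤ 0≤a 0≤e)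
          where
          0≤γ : 0ℚ ≤ γ b
          0≤γ = ℚP.<⇒≤ (0<recip (ℕ.pred (D⁴ b)))
          0≤a : 0ℚ ≤ a
          0≤a = ℚP.<⇒≤ (0<δ₁ c)
          0≤e : 0ℚ ≤ e
          0≤e = ℚP.<⇒≤ (0<δ₂ c′)
          γ≤a : γ b ≤ a
          γ≤a = γ≤δ b (q₁-bounded c) (p-bounded c) (0<δ₁ c)
          γ≤e : γ b ≤ e
          γ≤e = γ≤δ b (p-bounded c′) (q₂-bounded c′) (0<δ₂ c′)
          γ≤a+e : γ b ≤ a + e
          γ≤a+e = ℚP.≤-trans γ≤a (subst (_≤ a + e) (ℚP.+-identityʳ a) (ℚP.+-monoʳ-≤ a 0≤e))

        regular-bound : count (∁ Irregular) ℕ.< (count Irregular ℕ.* K ℕ.+ W) ℕ.* (D⁴ b ℕ.* D⁴ b ℕ.* D⁴ b)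
        regular-bound with sized (ℕP.<⇒≤ k<n)
        ... | X , count≡k
          with count<n⇒∃false X (subst (ℕ._< n) (sym count≡k) k<n)
             | 0<count⇒∃true X (subst (0 ℕ.<_) (sym count≡k) (ℕP.<-≤-trans 0<s s≤k))
        ...   | j , j∉X | i , i∈X = fromℕ*γ³<⇒< b (count (∁ Irregular)) (count Irregular ℕ.* K ℕ.+ W)
                  (ℚP.≤-<-trans (ℚP.*-monoˡ-≤-nonNeg cR {{ℚ.nonNegative (0≤fromℕ _)}} γ³≤mm) regular*mm<)
          where
          cI cR : ℚ
          cI = fromℕ (count Irregular)
          cR = fromℕ (count (∁ Irregular))
          regular*mm< : cR * mm < fromℕ (count Irregular ℕ.* K ℕ.+ W)
          regular*mm< = subst (cR * mm <_)
            (sym (trans (fromℕ-+ (count Irregular ℕ.* K) W) (cong (_+ fromℕ W) (fromℕ-* (count Irregular) K))))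
            (0<q-p⇒p<q (subst (0ℚ <_)
              (solve 4 (λ A r m w → A :+ r :* (:- m) :+ w := (A :+ w) :- r :* m) refl (cI * fromℕ K) cR mm (fromℕ W))
              (ℚP.<-≤-trans (exact-lower X count≡k i j i∈X j∉X) (ℚP.+-mono-≤ (eval-T≤ X) (correction≤W i j)))))

      n<Bound : s ℕ.+ s ℕ.≤ n → n ℕ.< Bound
      n<Bound 2s≤n = from-centres (N₁.nearly-constant 2s≤n) (N₂.nearly-constant 2s≤n)
        where
        from-centres : ∃[ c ] count (N₁.Off c) ℕ.< s ℕ.+ s → ∃[ c′ ] count (N₂.Off c′) ℕ.< s ℕ.+ s → n ℕ.< Bound
        from-centres (c , off₁) (c′ , off₂) = subst (ℕ._< Bound) (count+count∁ Irregular)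
          (ℕP.+-mono-<-≤ irregular< (ℕP.≤-trans (ℕP.<⇒≤ regular-bound)
            (ℕP.*-monoˡ-≤ (D⁴ b ℕ.* D⁴ b ℕ.* D⁴ b) (ℕP.+-monoˡ-≤ W (ℕP.*-monoˡ-≤ K (ℕP.<⇒≤ irregular<))))))
          where
          open Centred c c′
          irregular< : count Irregular ℕ.< s ℕ.+ s ℕ.+ (s ℕ.+ s)
          irregular< = ℕP.≤-<-trans (count-∪-≤ (N₁.Off c) (N₂.Off c′)) (ℕP.+-mono-< off₁ off₂)

  module Powers (B : ℕ) (2≤B : 2 ℕ.≤ B) where

    opaque

      B^ : ℕ → ℕ
      B^ a = B ^ a

      B^≡B^ : ∀ a → B^ a ≡ B ^ a
      B^≡B^ a = refl

      1≤B^ : ∀ a → 1 ℕ.≤ B^ a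
      1≤B^ zero    = s≤s z≤n
      1≤B^ (suc a) = ℕP.*-mono-≤ (ℕP.≤-trans (s≤s z≤n) 2≤B) (1≤B^ a)

      B≤B^1 : B ℕ.≤ B^ 1
      B≤B^1 = ℕP.≤-reflexive (sym (ℕP.*-identityʳ B))

      B^-mono : ∀ {a c} → a ℕ.≤ c → B^ a ℕ.≤ B^ c
      B^-mono {zero}  {c}     _         = 1≤B^ c
      B^-mono {suc a} {suc c} (s≤s a≤c) = ℕP.*-monoʳ-≤ B (B^-mono a≤c)

      ≤B^-+ : ∀ {x y a} → x ℕ.≤ B^ a → y ℕ.≤ B^ a → x ℕ.+ y ℕ.≤ B^ (suc a)
      ≤B^-+ {x} {y} {a} x≤ y≤ = ℕP.≤-trans (ℕP.+-mono-≤ x≤ y≤)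
        (ℕP.≤-trans (ℕP.≤-reflexive (cong (B^ a ℕ.+_) (sym (ℕP.+-identityʳ (B^ a))))) (ℕP.*-monoˡ-≤ (B^ a) 2≤B))

      ≤B^-* : ∀ {x y a c} → x ℕ.≤ B^ a → y ℕ.≤ B^ c → x ℕ.* y ℕ.≤ B^ (a ℕ.+ c)
      ≤B^-* {a = a} {c} x≤ y≤ = ℕP.≤-trans (ℕP.*-mono-≤ x≤ y≤) (ℕP.≤-reflexive (sym (ℕP.^-distribˡ-+-* B a c)))

    ≤B^-raise : ∀ {x a c} → x ℕ.≤ B^ a → a ℕ.≤ c → x ℕ.≤ B^ c
    ≤B^-raise x≤ a≤c = ℕP.≤-trans x≤ (B^-mono a≤c)

  module _ (b : ℕ) (2≤B : 2 ℕ.≤ suc b) where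

    open Powers (suc b) 2≤B
    open Constants b (suc b ℕ.+ 1)

    private
      M≤ : suc b ℕ.+ 1 ℕ.≤ B^ 2
      M≤ = ≤B^-+ {a = 1} B≤B^1 (1≤B^ 1)
      2M≤ : (suc b ℕ.+ 1) ℕ.+ (suc b ℕ.+ 1) ℕ.≤ B^ 3
      2M≤ = ≤B^-+ M≤ M≤
      D⁴≤ : D⁴ b ℕ.≤ B^ 4
      D⁴≤ = ≤B^-* {a = 2} {c = 2} (≤B^-* {a = 1} {c = 1} B≤B^1 B≤B^1) (≤B^-* {a = 1} {c = 1} B≤B^1 B≤B^1)
      s≤ : s ℕ.≤ B^ 7
      s≤ = ≤B^-* {a = 3} {c = 4} 2M≤ D⁴≤
      2s≤ : s ℕ.+ s ℕ.≤ B^ 8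
      2s≤ = ≤B^-+ s≤ s≤
      4s≤ : s ℕ.+ s ℕ.+ (s ℕ.+ s) ℕ.≤ B^ 9
      4s≤ = ≤B^-+ 2s≤ 2s≤
      1+M≤ : 1 ℕ.+ (suc b ℕ.+ 1) ℕ.≤ B^ 3
      1+M≤ = ≤B^-+ (1≤B^ 2) M≤
      K≤ : K ℕ.≤ B^ 10
      K≤ = ≤B^-+ K-half K-half
        where
        K-half : (suc b ℕ.+ 1 ℕ.+ (suc b ℕ.+ 1)) ℕ.* ((1 ℕ.+ (suc b ℕ.+ 1)) ℕ.* (1 ℕ.+ (suc b ℕ.+ 1))) ℕ.≤ B^ 9
        K-half = ≤B^-* {a = 3} {c = 6} 2M≤ (≤B^-* {a = 3} {c = 3} 1+M≤ 1+M≤)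
      W≤ : W ℕ.≤ B^ 8
      W≤ = ≤B^-+ W-half W-half
        where
        W-half : (suc b ℕ.+ 1 ℕ.+ (suc b ℕ.+ 1)) ℕ.* (2 ℕ.* (suc b ℕ.+ 1 ℕ.+ (suc b ℕ.+ 1))) ℕ.≤ B^ 7
        W-half = ≤B^-* {a = 3} {c = 4} 2M≤ (≤B^-* {a = 1} {c = 3} (ℕP.≤-trans 2≤B B≤B^1) 2M≤)

    Bound≤B^33 : Bound ℕ.≤ suc b ^ 33
    Bound≤B^33 = subst (Bound ℕ.≤_) (B^≡B^ 33) (≤B^-+ {a = 32} (≤B^-raise 4s≤ (ℕP.+-monoʳ-≤ 9 z≤n))
      (≤B^-* {a = 20} {c = 12} (≤B^-+ (≤B^-* {a = 9} {c = 10} 4s≤ K≤) (≤B^-raise W≤ (ℕP.+-monoʳ-≤ 8 z≤n)))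
                               (≤B^-* {a = 8} {c = 4} (≤B^-* {a = 4} {c = 4} D⁴≤ D⁴≤) D⁴≤)))

    2s+3≤B^33 : s ℕ.+ s ℕ.+ 3 ℕ.≤ suc b ^ 33
    2s+3≤B^33 = subst (s ℕ.+ s ℕ.+ 3 ℕ.≤_) (B^≡B^ 33)
      (≤B^-raise (≤B^-+ {a = 8} 2s≤ (≤B^-raise 3≤ (ℕP.+-monoʳ-≤ 2 z≤n))) (ℕP.+-monoʳ-≤ 9 z≤n))
      where
      3≤ : 3 ℕ.≤ B^ 2
      3≤ = ℕP.≤-trans (s≤s (s≤s (s≤s z≤n))) (≤B^-* {a = 1} {c = 1} (ℕP.≤-trans 2≤B B≤B^1) (ℕP.≤-trans 2≤B B≤B^1))

  -- The level set described by c₁ < 0 ∨ c₂ < 0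

  record ExactByEither {n} (k : ℕ) (c₁ c₂ : Separable n) : Set where
    field
      exact   : ∀ X → count X ≡ k → eval c₁ X < 0ℚ ⊎ eval c₂ X < 0ℚ
      inexact : ∀ X → ¬ (count X ≡ k) → 0ℚ < eval c₁ X × 0ℚ < eval c₂ X

  module _ {n k} {c₁ c₂ : Separable n} (E : ExactByEither (suc k) c₁ c₂) where

    open ExactByEither E

    -- The sets Z and Z ∪ {u, v} are rejected, while by exchange their values add up to those of
    -- the exact sets Z ∪ {u} and Z ∪ {v}.
    accepted-by-both : ∀ (c : Separable n) → (∀ X → ¬ (count X ≡ suc k) → 0ℚ < eval c X) →
      ∀ Z → count Z ≡ k → ∀ {u v} → ¬ (u ≡ v) → Z u ≡ false → Z v ≡ false →
      eval c (Z [ u ]≔ true) < 0ℚ → eval c (Z [ v ]≔ true) < 0ℚ → ⊥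
    accepted-by-both c rejects Z count-Z {u} {v} u≢v u∉Z v∉Z Zu<0 Zv<0 =
      ℚP.<-asym (ℚP.+-mono-< (rejects Z (ℕP.1+n≢n ∘ trans (cong suc count-Z) ∘ sym)) (rejects Zuv Zuv-inexact))
                (subst (_< 0ℚ) (eval-exchange c Z u≢v u∉Z v∉Z) (p<0∧q<0⇒p+q<0 Zu<0 Zv<0))
      where
      Zuv : Fin n → Bool
      Zuv = (Z [ u ]≔ true) [ v ]≔ true
      Zuv-inexact : ¬ (count Zuv ≡ suc k)
      Zuv-inexact = ℕP.1+n≢n ∘ trans (sym (trans (count-[]≔true (Z [ u ]≔ true) v (trans (updateAt-minimal v u Z (u≢v ∘ sym)) v∉Z))
                                                  (cong suc (trans (count-[]≔true Z u u∉Z) (cong suc count-Z)))))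

    three-exact : ∀ Z → count Z ≡ k → ∀ {i j l} → ¬ (i ≡ j) → ¬ (i ≡ l) → ¬ (j ≡ l) →
      Z i ≡ false → Z j ≡ false → Z l ≡ false → ⊥
    three-exact Z count-Z {i} {j} {l} i≢j i≢l j≢l i∉Z j∉Z l∉Z
      with exact (Z [ i ]≔ true) (exact-size i∉Z)
         | exact (Z [ j ]≔ true) (exact-size j∉Z)
         | exact (Z [ l ]≔ true) (exact-size l∉Z)
      where
      exact-size : ∀ {u} → Z u ≡ false → count (Z [ u ]≔ true) ≡ suc k
      exact-size {u} u∉Z = trans (count-[]≔true Z u u∉Z) (cong suc count-Z)
    ... | inj₁ x | inj₁ y | _      = accepted-by-both c₁ (λ X → proj₁ ∘ inexact X) Z count-Z i≢j i∉Z j∉Z x y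
    ... | inj₂ x | inj₂ y | _      = accepted-by-both c₂ (λ X → proj₂ ∘ inexact X) Z count-Z i≢j i∉Z j∉Z x y
    ... | inj₁ x | inj₂ _ | inj₁ z = accepted-by-both c₁ (λ X → proj₁ ∘ inexact X) Z count-Z i≢l i∉Z l∉Z x z
    ... | inj₂ x | inj₁ _ | inj₂ z = accepted-by-both c₂ (λ X → proj₂ ∘ inexact X) Z count-Z i≢l i∉Z l∉Z x z
    ... | inj₂ _ | inj₁ y | inj₁ z = accepted-by-both c₁ (λ X → proj₁ ∘ inexact X) Z count-Z j≢l j∉Z l∉Z y z
    ... | inj₁ _ | inj₂ y | inj₂ z = accepted-by-both c₂ (λ X → proj₂ ∘ inexact X) Z count-Z j≢l j∉Z l∉Z y z

  ExactByEither-impossible : ∀ {n k} {c₁ c₂ : Separable n} → ExactByEither k c₁ c₂ → 1 ℕ.≤ k → k ℕ.+ 2 ℕ.≤ n → ⊥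
  ExactByEither-impossible {n} {suc k} E _ k+2≤n =
    from-padding (extend ∅ (⁅ i ⁆ ∪ (⁅ j ⁆ ∪ ⁅ l ⁆)) k (λ _ ()) (subst (ℕ._≤ k) (sym (count-∅ {n})) z≤n) room)
    where
    2<n : 2 ℕ.< n
    2<n = ℕP.≤-trans (ℕP.+-monoˡ-≤ 2 (s≤s z≤n)) k+2≤n
    i j l : Fin n
    i = Fin.fromℕ< (ℕP.<-trans (s≤s z≤n) (ℕP.<-trans (s≤s (s≤s z≤n)) 2<n))
    j = Fin.fromℕ< (ℕP.<-trans (s≤s (s≤s z≤n)) 2<n)
    l = Fin.fromℕ< 2<n
    room : k ℕ.+ count (⁅ i ⁆ ∪ (⁅ j ⁆ ∪ ⁅ l ⁆)) ℕ.≤ n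
    room = ℕP.≤-trans (ℕP.+-monoʳ-≤ k count≤3) (subst (ℕ._≤ n) (sym (ℕP.+-suc k 2)) k+2≤n)
      where
      count≤3 : count (⁅ i ⁆ ∪ (⁅ j ⁆ ∪ ⁅ l ⁆)) ℕ.≤ 3
      count≤3 = ℕP.≤-trans (count-∪-≤ ⁅ i ⁆ (⁅ j ⁆ ∪ ⁅ l ⁆)) (ℕP.+-mono-≤ (ℕP.≤-reflexive (count-⁅i⁆ i))
                  (ℕP.≤-trans (count-∪-≤ ⁅ j ⁆ ⁅ l ⁆) (ℕP.≤-reflexive (cong₂ ℕ._+_ (count-⁅i⁆ j) (count-⁅i⁆ l)))))
    i≢j : ¬ (i ≡ j)
    i≢j = (λ ()) ∘ FinP.fromℕ<-injective 0 1 _ _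
    i≢l : ¬ (i ≡ l)
    i≢l = (λ ()) ∘ FinP.fromℕ<-injective 0 2 _ _
    j≢l : ¬ (j ≡ l)
    j≢l = (λ ()) ∘ FinP.fromℕ<-injective 1 2 _ _
    from-padding : Extension ∅ (⁅ i ⁆ ∪ (⁅ j ⁆ ∪ ⁅ l ⁆)) k → ⊥
    from-padding (Z , count-Z , _ , avoid) = three-exact E Z count-Z i≢j i≢l j≢l
      (avoid i (∨-true-l (∈⁅i⁆ i)))
      (avoid j (∨-true-r (⁅ i ⁆ j) (∨-true-l (∈⁅i⁆ j))))
      (avoid l (∨-true-r (⁅ i ⁆ l) (∨-true-r (⁅ j ⁆ l) (∈⁅i⁆ l))))

  -- Nearest-neighbour representations of exactF

  level : ℕ → ℕ
  level n = n ℕ./ 2 ℕ.+ 1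

  half+half≤n : ∀ n → n ℕ./ 2 ℕ.+ n ℕ./ 2 ℕ.≤ n
  half+half≤n n = subst (ℕ._≤ n) (trans (ℕP.*-comm (n ℕ./ 2) 2) (cong (n ℕ./ 2 ℕ.+_) (ℕP.+-identityʳ (n ℕ./ 2))))
                    (ℕ.m/n*n≤m n 2)

  ≤half : ∀ m n → m ℕ.* 2 ℕ.≤ n → m ℕ.≤ n ℕ./ 2
  ≤half m n m*2≤n = subst (ℕ._≤ n ℕ./ 2) (ℕ.m*n/n≡m m 2) (ℕ./-monoˡ-≤ 2 m*2≤n)

  1≤level : ∀ n → 1 ℕ.≤ level n
  1≤level n = ℕP.m≤n+m 1 (n ℕ./ 2)

  level+2≤n : ∀ {n} → 8 ℕ.≤ n → level n ℕ.+ 2 ℕ.≤ n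
  level+2≤n {n} 8≤n = subst (ℕ._≤ n) (sym (ℕP.+-assoc (n ℕ./ 2) 1 2))
    (ℕP.≤-trans (ℕP.+-monoʳ-≤ (n ℕ./ 2) (≤half 3 n (ℕP.≤-trans (ℕP.m≤m+n 6 2) 8≤n))) (half+half≤n n))

  level<n : ∀ {n} → 8 ℕ.≤ n → level n ℕ.< n
  level<n {n} 8≤n = ℕP.≤-trans (ℕP.≤-trans (ℕP.≤-reflexive (ℕP.+-comm 1 (level n))) (ℕP.+-monoʳ-≤ (level n) (ℕP.n≤1+n 1)))
                               (level+2≤n 8≤n)

  module _ {n s} (2s+3≤n : s ℕ.+ s ℕ.+ 3 ℕ.≤ n) where

    private
      s+1≤half : s ℕ.+ 1 ℕ.≤ n ℕ./ 2
      s+1≤half = ≤half (s ℕ.+ 1) n (ℕP.≤-trans (ℕP.≤-reflexive (ℕP.*-distribʳ-+ 2 s 1))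
        (ℕP.≤-trans (ℕP.≤-reflexive (cong (ℕ._+ 2) (trans (ℕP.*-comm s 2) (cong (s ℕ.+_) (ℕP.+-identityʳ s)))))
          (ℕP.≤-trans (ℕP.+-monoʳ-≤ (s ℕ.+ s) (ℕP.n≤1+n 2)) 2s+3≤n)))

    s≤level : s ℕ.≤ level n
    s≤level = ℕP.≤-trans (ℕP.m≤m+n s 1) (ℕP.≤-trans s+1≤half (ℕP.m≤m+n (n ℕ./ 2) 1))

    level+s≤n : level n ℕ.+ s ℕ.≤ n
    level+s≤n = ℕP.≤-trans (ℕP.≤-reflexive (trans (ℕP.+-assoc (n ℕ./ 2) 1 s) (cong (n ℕ./ 2 ℕ.+_) (ℕP.+-comm 1 s))))
                  (ℕP.≤-trans (ℕP.+-monoʳ-≤ (n ℕ./ 2) s+1≤half) (half+half≤n n))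

    2s≤n : s ℕ.+ s ℕ.≤ n
    2s≤n = ℕP.≤-trans (ℕP.m≤m+n (s ℕ.+ s) 3) 2s+3≤n

  oriented-bound : ∀ {n} (p q₁ q₂ : Fin n → ℚ) b → 2 ℕ.≤ suc b → 8 ℕ.≤ n →
    ExactByBoth (level n) (comparison p q₁) (comparison p q₂) → Oriented (comparison p q₁) (comparison p q₂) →
    (∀ j → Bounded (suc b) (suc b ℕ.+ 1) (p j)) → (∀ j → Bounded (suc b) (suc b ℕ.+ 1) (q₁ j)) →
    (∀ j → Bounded (suc b) (suc b ℕ.+ 1) (q₂ j)) → n ℕ.≤ suc b ^ 33
  oriented-bound {n} p q₁ q₂ b 2≤B 8≤n E O p-bounded q₁-bounded q₂-bounded = by-size (s ℕ.+ s ℕ.+ 3 ℕ.≤? n)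
    where
    open Constants b (suc b ℕ.+ 1)
    by-size : Dec (s ℕ.+ s ℕ.+ 3 ℕ.≤ n) → n ℕ.≤ suc b ^ 33
    by-size (no 2s+3≰n)  = ℕP.≤-trans (ℕP.<⇒≤ (ℕP.≰⇒> 2s+3≰n)) (2s+3≤B^33 b 2≤B)
    by-size (yes 2s+3≤n) = ℕP.≤-trans
      (ℕP.<⇒≤ (Balanced.n<Bound (s≤level {s = s} 2s+3≤n) (level+s≤n {s = s} 2s+3≤n) (2s≤n {s = s} 2s+3≤n)))
      (Bound≤B^33 b 2≤B)
      where
      open SinglePositive p q₁ q₂ b (suc b ℕ.+ 1) E O (level<n 8≤n) (ℕP.m≤n+m 1 (suc b)) p-bounded q₁-bounded q₂-bounded

  ones-tabulate : ∀ {n} (X : Fin n → Bool) → ones (tabulate X) ≡ count X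
  ones-tabulate {zero}  X = refl
  ones-tabulate {suc n} X with X zero
  ... | true  = cong suc (ones-tabulate (tail X))
  ... | false = ones-tabulate (tail X)

  exactF-tabulate : ∀ {n} (X : Fin n → Bool) → exactF n (tabulate X) ≡ does (count X ℕ.≟ level n)
  exactF-tabulate {n} X = cong (ℕ._≡ᵇ level n) (ones-tabulate X)

  dist²-tabulate : ∀ {n} (X : Fin n → Bool) (v : Vec ℚ n) → dist² (tabulate X) v ≡ ∑ (λ j → sq (bit (X j) - lookup v j))
  dist²-tabulate {zero}  X []      = refl
  dist²-tabulate {suc n} X (x ∷ v) = cong (_+_ (sq (bit (X zero) - x))) (dist²-tabulate (tail X) v)

  dist²-difference : ∀ {n} (X : Fin n → Bool) (p q : Vec ℚ n) →
    dist² (tabulate X) p - dist² (tabulate X) q ≡ eval (comparison (lookup p) (lookup q)) X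
  dist²-difference X p q = trans (cong₂ _-_ (dist²-tabulate X p) (dist²-tabulate X q))
                                 (sym (∑-- (λ j → sq (bit (X j) - lookup p j)) (λ j → sq (bit (X j) - lookup q j))))

  module _ {n} (X : Fin n → Bool) (p q : Vec ℚ n) where

    closer⇒eval<0 : dist² (tabulate X) p < dist² (tabulate X) q → eval (comparison (lookup p) (lookup q)) X < 0ℚ
    closer⇒eval<0 lt = subst (_< 0ℚ) (dist²-difference X p q) (0<q-p⇒p<q (subst (0ℚ <_)
      (solve 2 (λ x y → y :- x := con 0ℚ :- (x :- y)) refl (dist² (tabulate X) p) (dist² (tabulate X) q)) (p<q⇒0<q-p lt)))

    farther⇒0<eval : dist² (tabulate X) q < dist² (tabulate X) p → 0ℚ < eval (comparison (lookup p) (lookup q)) X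
    farther⇒0<eval lt = subst (0ℚ <_) (dist²-difference X p q) (p<q⇒0<q-p lt)

  module _ {n} {P N : List (Vec ℚ n)} (rep : IsNNRep (exactF n) P N) where

    accepted : ∀ X → count X ≡ level n →
      ∃[ p ] (p ∈ P × ∀ q → q ∈ N → dist² (tabulate X) p < dist² (tabulate X) q)
    accepted X exact = proj₁ rep (tabulate X) (trans (exactF-tabulate X) (dec-true (count X ℕ.≟ level n) exact))

    rejected : ∀ X → ¬ (count X ≡ level n) →
      ∃[ q ] (q ∈ N × ∀ p → p ∈ P → dist² (tabulate X) q < dist² (tabulate X) p)
    rejected X inexact = proj₂ rep (tabulate X) (trans (exactF-tabulate X) (dec-false (count X ℕ.≟ level n) inexact))

  rep⇒ExactByBoth : ∀ {n} {p q₁ q₂ : Vec ℚ n} → IsNNRep (exactF n) (p ∷ []) (q₁ ∷ q₂ ∷ []) →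
    ExactByBoth (level n) (comparison (lookup p) (lookup q₁)) (comparison (lookup p) (lookup q₂))
  ExactByBoth.exact (rep⇒ExactByBoth {p = p} {q₁} {q₂} rep) X count≡level with accepted rep X count≡level
  ... | _ , here refl , closer =
    closer⇒eval<0 X p q₁ (closer q₁ (here refl)) , closer⇒eval<0 X p q₂ (closer q₂ (there (here refl)))
  ExactByBoth.inexact (rep⇒ExactByBoth {p = p} {q₁} {q₂} rep) X count≢level with rejected rep X count≢level
  ... | _ , here refl         , closer = inj₁ (farther⇒0<eval X p q₁ (closer p (here refl)))
  ... | _ , there (here refl) , closer = inj₂ (farther⇒0<eval X p q₂ (closer p (here refl)))

  rep⇒ExactByEither : ∀ {n} {p₁ p₂ q : Vec ℚ n} → IsNNRep (exactF n) (p₁ ∷ p₂ ∷ []) (q ∷ []) →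
    ExactByEither (level n) (comparison (lookup p₁) (lookup q)) (comparison (lookup p₂) (lookup q))
  ExactByEither.exact (rep⇒ExactByEither {p₁ = p₁} {p₂} {q} rep) X count≡level with accepted rep X count≡level
  ... | _ , here refl         , closer = inj₁ (closer⇒eval<0 X p₁ q (closer q (here refl)))
  ... | _ , there (here refl) , closer = inj₂ (closer⇒eval<0 X p₂ q (closer q (here refl)))
  ExactByEither.inexact (rep⇒ExactByEither {p₁ = p₁} {p₂} {q} rep) X count≢level with rejected rep X count≢level
  ... | _ , here refl , closer =
    farther⇒0<eval X p₁ q (closer p₁ (here refl)) , farther⇒0<eval X p₂ q (closer p₂ (there (here refl)))

  no-positive-anchor : ∀ {n} {N : List (Vec ℚ n)} → 8 ℕ.≤ n → ¬ IsNNRep (exactF n) [] N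
  no-positive-anchor 8≤n rep with sized (ℕP.<⇒≤ (level<n 8≤n))
  ... | X , count≡level with accepted rep X count≡level
  ...   | _ , () , _

  no-negative-anchor : ∀ {n} {P : List (Vec ℚ n)} → ¬ IsNNRep (exactF n) P []
  no-negative-anchor {n} rep with rejected rep ∅ (λ e → ℕP.<-irrefl (trans (sym (count-∅ {n})) e) (1≤level n))
  ... | _ , () , _

  RES-lookup≤ : ∀ {n} (v : Vec ℚ n) j → RES (lookup v j) ℕ.≤ resVec v
  RES-lookup≤ (x ∷ v) zero    = ℕP.m≤m⊔n (RES x) (resVec v)
  RES-lookup≤ (x ∷ v) (suc j) = ℕP.≤-trans (RES-lookup≤ v j) (ℕP.m≤n⊔m (RES x) (resVec v))

  ∣z∣≤∣z+1∣+1 : ∀ z → ℤ.∣ z ∣ ℕ.≤ ℤ.∣ z ℤ.+ + 1 ∣ ℕ.+ 1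
  ∣z∣≤∣z+1∣+1 z = subst (λ w → ℤ.∣ w ∣ ℕ.≤ ℤ.∣ z ℤ.+ + 1 ∣ ℕ.+ 1) (trans (ℤP.+-assoc z (+ 1) -[1+ 0 ]) (ℤP.+-identityʳ z))
                    (ℤP.∣i+j∣≤∣i∣+∣j∣ (z ℤ.+ + 1) -[1+ 0 ])

  RES-bounds : ∀ x R → RES x ℕ.≤ R → ↧ₙ x ℕ.+ 1 ℕ.≤ 2 ^ R × ℤ.∣ ↥ x ∣ ℕ.≤ 2 ^ R ℕ.+ 1
  RES-bounds x R RES≤R =
    ⌈log₂⌉≤⇒≤2^ (↧ₙ x ℕ.+ 1) R (ℕP.m⊔n≤o⇒n≤o _ _ RES≤R) ,
    ℕP.≤-trans (∣z∣≤∣z+1∣+1 (↥ x)) (ℕP.+-monoˡ-≤ 1 (⌈log₂⌉≤⇒≤2^ ℤ.∣ ↥ x ℤ.+ + 1 ∣ R (ℕP.m⊔n≤o⇒m≤o _ _ RES≤R)))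

  RES≤⇒Bounded : ∀ x R → RES x ℕ.≤ R → Bounded (2 ^ R) (2 ^ R ℕ.+ 1) x
  RES≤⇒Bounded x R RES≤R with RES-bounds x R RES≤R
  ... | ↧x+1≤ , ∣↥x∣≤ = ℕP.m+n≤o⇒m≤o (↧ₙ x) ↧x+1≤ , ∣↥p∣≤N⇒∣p∣≤N x _ ∣↥x∣≤

  RES≤⇒2≤2^ : ∀ x R → RES x ℕ.≤ R → 2 ℕ.≤ 2 ^ R
  RES≤⇒2≤2^ x@(mkℚ _ _ _) R RES≤R = ℕP.≤-trans (ℕP.+-monoˡ-≤ 1 (s≤s z≤n)) (proj₁ (RES-bounds x R RES≤R))

  single-positive-bound : ∀ {n} → 8 ℕ.≤ n → (p q₁ q₂ : Vec ℚ n) → IsNNRep (exactF n) (p ∷ []) (q₁ ∷ q₂ ∷ []) →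
    n ℕ.≤ (2 ^ resolution (p ∷ q₁ ∷ q₂ ∷ [])) ^ 33
  single-positive-bound {n} 8≤n p q₁ q₂ rep = with-base (ℕ.pred (2 ^ R)) (sym (ℕP.suc-pred (2 ^ R) {{ℕP.m^n≢0 2 R}}))
    where
    R : ℕ
    R = resolution (p ∷ q₁ ∷ q₂ ∷ [])
    E : ExactByBoth (level n) (comparison (lookup p) (lookup q₁)) (comparison (lookup p) (lookup q₂))
    E = rep⇒ExactByBoth rep
    bounded : ∀ v → resVec v ℕ.≤ R → ∀ j → Bounded (2 ^ R) (2 ^ R ℕ.+ 1) (lookup v j)
    bounded v v≤R j = RES≤⇒Bounded (lookup v j) R (ℕP.≤-trans (RES-lookup≤ v j) v≤R)
    p≤R : resVec p ℕ.≤ R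
    p≤R = ℕP.m≤m⊔n (resVec p) _
    q₁≤R : resVec q₁ ℕ.≤ R
    q₁≤R = ℕP.≤-trans (ℕP.m≤m⊔n (resVec q₁) _) (ℕP.m≤n⊔m (resVec p) _)
    q₂≤R : resVec q₂ ℕ.≤ R
    q₂≤R = ℕP.≤-trans (ℕP.m≤m⊔n (resVec q₂) 0) (ℕP.≤-trans (ℕP.m≤n⊔m (resVec q₁) _) (ℕP.m≤n⊔m (resVec p) _))
    with-base : ∀ b → 2 ^ R ≡ suc b → n ℕ.≤ (2 ^ R) ^ 33
    with-base b 2^R≡B = subst (λ B → n ℕ.≤ B ^ 33) (sym 2^R≡B) (by-orientation (orientation E (1≤level n) (level<n 8≤n)))
      where
      bounded′ : ∀ v → resVec v ℕ.≤ R → ∀ j → Bounded (suc b) (suc b ℕ.+ 1) (lookup v j)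
      bounded′ v v≤R = subst (λ B → ∀ j → Bounded B (B ℕ.+ 1) (lookup v j)) 2^R≡B (bounded v v≤R)
      2≤B : 2 ℕ.≤ suc b
      2≤B = subst (2 ℕ.≤_) 2^R≡B (RES≤⇒2≤2^ (lookup p (Fin.fromℕ< 8≤n)) R (ℕP.≤-trans (RES-lookup≤ p (Fin.fromℕ< 8≤n)) p≤R))
      by-orientation : Oriented (comparison (lookup p) (lookup q₁)) (comparison (lookup p) (lookup q₂)) ⊎
                       Oriented (comparison (lookup p) (lookup q₂)) (comparison (lookup p) (lookup q₁)) → n ℕ.≤ suc b ^ 33
      by-orientation (inj₁ O) = oriented-bound (lookup p) (lookup q₁) (lookup q₂) b 2≤B 8≤n E O
                                  (bounded′ p p≤R) (bounded′ q₁ q₁≤R) (bounded′ q₂ q₂≤R)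
      by-orientation (inj₂ O) = oriented-bound (lookup p) (lookup q₂) (lookup q₁) b 2≤B 8≤n (ExactByBoth-swap E) O
                                  (bounded′ p p≤R) (bounded′ q₂ q₂≤R) (bounded′ q₁ q₁≤R)

  ⌊log₂⌋≤ : ∀ n R → n ℕ.≤ (2 ^ R) ^ 33 → ⌊log₂ n ⌋ ℕ.≤ 33 ℕ.* R
  ⌊log₂⌋≤ n R n≤ = ℕP.≤-trans (⌊log₂⌋-mono-≤ n≤) (ℕP.≤-reflexive (begin
    ⌊log₂ (2 ^ R) ^ 33 ⌋  ≡⟨ cong ⌊log₂_⌋ (ℕP.^-*-assoc 2 R 33) ⟩
    ⌊log₂ 2 ^ (R ℕ.* 33) ⌋ ≡⟨ ⌊log₂[2^n]⌋≡n (R ℕ.* 33) ⟩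
    R ℕ.* 33              ≡⟨ ℕP.*-comm R 33 ⟩
    33 ℕ.* R              ∎))
    where open ≡-Reasoning

  three-anchors : ∀ {n} → 8 ℕ.≤ n → (P N : List (Vec ℚ n)) → length (P ++ N) ≡ 3 → IsNNRep (exactF n) P N →
    ⌊log₂ n ⌋ ℕ.≤ 33 ℕ.* resolution (P ++ N)
  three-anchors     8≤n []                    N                    _ rep = ⊥-elim (no-positive-anchor 8≤n rep)
  three-anchors {n} 8≤n (p ∷ [])              (q₁ ∷ q₂ ∷ [])       _ rep =
    ⌊log₂⌋≤ n (resolution (p ∷ q₁ ∷ q₂ ∷ [])) (single-positive-bound 8≤n p q₁ q₂ rep)
  three-anchors {n} 8≤n (p₁ ∷ p₂ ∷ [])        (q ∷ [])             _ rep =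
    ⊥-elim (ExactByEither-impossible (rep⇒ExactByEither rep) (1≤level n) (level+2≤n 8≤n))
  three-anchors     8≤n (p₁ ∷ p₂ ∷ p₃ ∷ [])   []                   _ rep = ⊥-elim (no-negative-anchor rep)
  three-anchors 8≤n (_ ∷ [])             []                  ()
  three-anchors 8≤n (_ ∷ [])             (_ ∷ [])            ()
  three-anchors 8≤n (_ ∷ [])             (_ ∷ _ ∷ _ ∷ _)     ()
  three-anchors 8≤n (_ ∷ _ ∷ [])         []                  ()
  three-anchors 8≤n (_ ∷ _ ∷ [])         (_ ∷ _ ∷ _)         ()
  three-anchors 8≤n (_ ∷ _ ∷ _ ∷ [])     (_ ∷ _)             ()
  three-anchors 8≤n (_ ∷ _ ∷ _ ∷ _ ∷ _)  _                   ()

open import Data.Nat using (ℕ; _≤_; _*_)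
open import Data.Nat.Logarithm using (⌊log₂_⌋)
open import Data.Rational using (ℚ)
open import Data.Vec using (Vec)
open import Data.List using (List; _++_; length)
open import Data.List.Relation.Unary.Unique.Propositional using (Unique)
open import Data.Product using (∃-syntax; _,_)
open import Relation.Binary.PropositionalEquality using (_≡_)

theorem7 : ∃[ c ] ∃[ n₀ ] ((n : ℕ) → n₀ ≤ n →
             (P N : List (Vec ℚ n)) → Unique (P ++ N) → length (P ++ N) ≡ 3 →
             IsNNRep (exactF n) P N →
             ⌊log₂ n ⌋ ≤ c * resolution (P ++ N))
theorem7 = 33 , 8 , λ n 8≤n P N _ → three-anchors 8≤n P N
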